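{- Let $\ell\ge2$, let $D=(b|g;f_1,\dots,f_\ell)=(d_{n,k})_{n,k\ge0}$ be a multiple almost-Riordan array with $A$-, $Z_j$- ($j=1,\dots,\ell$) and $W$-sequences having generating functions $A(t)=\sum_k a_kt^{\ell k}$, $Z_j(t)=\sum_k z_{j,k}t^{\ell k}$, $W(t)=\sum_k w_kt^{\ell k}$, given explicitly by $A(t)=t^\ell/\overline h^\ell$, $Z_m(t)=\overline h^{ -\ell}\bigl(1-\frac{g_0f_{1,1}\cdots f_{m-1,1}\overline h^{m-1}}{g(\overline h)f_1(\overline h)\cdots f_{m-1}(\overline h)}\bigr)$ for $m=1,\dots,\ell-1$ (empty products equal $1$), $Z_\ell(t)=\frac{g_0f_{1,1}\cdots f_{\ell-1,1}}{b_0}+\frac{t^\ell}{\overline h^\ell}-\frac{g_0f_{1,1}\cdots f_{\ell-1,1}b(\overline h)f_\ell(\overline h)}{b_0\overline h g(\overline h)}$, $W(t)=\frac{f_\ell(\overline h)((1-w_0\overline h^\ell)b(\overline h)-b_0)}{\overline h^{\ell+1}g(\overline h)}+w_0$ with $w_0=b_\ell/b_0$. Then $D$ has the production matrix $$P=\bigl(W(t),\ tZ_1(t),\ t^2Z_2(t),\dots,\ t^{\ell-1}Z_{\ell-1}(t),\ Z_\ell(t),\ tA(t),\ t^2A(t),\ t^3A(t),\dots\bigr),$$ i.e. the matrix whose columns $0,1,\dots,\ell-1,\ell,\ell+1,\ell+2,\dots$ have the listed generating functions.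
   Context: Fix an integer $\ell\ge2$ and a field $\mathbb K$ of characteristic $0$; $\mathbb K[[t^\ell]]$ denotes the formal power series in $t^\ell$. Let $b,g\in\mathbb K[[t^\ell]]$ with $b_0:=b(0)\ne0$, $g_0:=g(0)\ne0$, $b_\ell:=[t^\ell]b$, and $f_1,\dots,f_\ell\in t\mathbb K[[t^\ell]]$ with $f_{j,1}:=[t]f_j\ne0$. The multiple almost-Riordan array $(b|g;f_1,\dots,f_\ell)$ is the infinite lower triangular matrix $(d_{n,k})_{n,k\ge0}$ with $d_{n,0}=[t^n]b(t)$ and, for $k\ge1$, $d_{n,k}=[t^n]\,t\,g\,f_1^{e_1(k)}\cdots f_\ell^{e_\ell(k)}$ with $e_i(k)=\lfloor (k-1+\ell-i)/\ell\rfloor$ (columns $b, tg, tgf_1, tgf_1f_2,\dots,tgf_1\cdots f_\ell, tgf_1^2f_2\cdots f_\ell,\dots$). Its $A$-, $Z_j$-, $W$-sequences are the sequences satisfying, for all $n\ge0$: $d_{n+\ell,k}=\sum_{j\ge0}a_jd_{n,k-\ell+\ell j}$ for $k>\ell$; $d_{n+\ell,m}=\sum_{j\ge0}z_{m,j}d_{n,m+\ell j}$ for $1\le m\le\ell-1$; $d_{n+\ell,\ell}=\sum_{j\ge0}z_{\ell,j}d_{n,\ell j}$; $d_{n+\ell,0}=\sum_{j\ge0}w_jd_{n,\ell j}$. A production matrix of $D$ in this setting is a matrix $P$ with $DP$ equal to the matrix obtained from $D$ by deleting its first $\ell$ rows, i.e. $(DP)_{n,k}=d_{n+\ell,k}$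 for all $n,k\ge0$. $h\in t\mathbb K[[t]]$ is a power series with $h^\ell=f_1\cdots f_\ell$ (assumed to exist), $\overline h$ its compositional inverse. -}

module Defs where

open import Level using (Level; _⊔_)
open import Data.Nat as ℕ using (ℕ; zero; suc; _∸_; NonZero; _<ᵇ_; _≡ᵇ_)
open import Data.Nat.DivMod using (_/_)
open import Data.Nat.Divisibility using (_∣_)
open import Data.Bool using (if_then_else_)
open import Relation.Nullary using (¬_)
open import Algebra.Bundles using (CommutativeRing)

-- A field: a commutative ring with 1 ≠ 0 together with an inverse operation
-- that inverts every non-zero element (the value of inv at 0 is irrelevant).
record IsField {a r} (R : CommutativeRing a r)
               (inv : CommutativeRing.Carrier R → CommutativeRing.Carrier R) : Set (a ⊔ r) where
  open CommutativeRing R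
  field
    1≉0     : ¬ (1# ≈ 0#)
    inverse : ∀ x → ¬ (x ≈ 0#) → x * inv x ≈ 1#

module _ {a r} (R : CommutativeRing a r) where
  open CommutativeRing R
  natK : ℕ → Carrier
  natK zero    = 0#
  natK (suc n) = 1# + natK n

  CharZero : Set r
  CharZero = ∀ n → ¬ (natK (suc n) ≈ 0#)

module Series {a r} (R : CommutativeRing a r) (inv : CommutativeRing.Carrier R → CommutativeRing.Carrier R) where
  open CommutativeRing R

  FPS : Set a
  FPS = ℕ → Carrier

  _≋_ : FPS → FPS → Set r
  f ≋ g = ∀ n → f n ≈ g n

  Σ≤ : ℕ → (ℕ → Carrier) → Carrier
  Σ≤ zero    F = F 0
  Σ≤ (suc n) F = Σ≤ n F + F (suc n)

  zeroS oneS : FPS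
  zeroS n = 0#
  oneS zero    = 1#
  oneS (suc n) = 0#

  const : Carrier → FPS
  const c zero    = c
  const c (suc n) = 0#

  mono : ℕ → FPS
  mono zero    zero    = 1#
  mono zero    (suc n) = 0#
  mono (suc k) zero    = 0#
  mono (suc k) (suc n) = mono k n

  X : FPS
  X = mono 1

  _⊕_ _⊖_ _⊛_ : FPS → FPS → FPS
  (f ⊕ g) n = f n + g n
  (f ⊖ g) n = f n - g n
  (f ⊛ g) n = Σ≤ n (λ i → f i * g (n ∸ i))

  infixl 6 _⊕_ _⊖_
  infixl 7 _⊛_

  scale : Carrier → FPS → FPS
  scale c f n = c * f n

  pow : FPS → ℕ → FPS
  pow f zero    = oneS
  pow f (suc k) = pow f k ⊛ f

  -- f / t^k  (exact when the first k coefficients of f vanish)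
  shift : ℕ → FPS → FPS
  shift k f n = f (n ℕ.+ k)

  -- composition f(h) for h with h(0) = 0
  comp : FPS → FPS → FPS
  comp f h n = Σ≤ n (λ k → f k * pow h k n)

  -- multiplicative inverse of a series with invertible constant term:
  -- 1/f = f₀⁻¹ Σ_k (1 - f₀⁻¹ f)^k
  invS : FPS → FPS
  invS f n = inv (f 0) * Σ≤ n (λ k → pow (oneS ⊖ scale (inv (f 0)) f) k n)

  prodS : ℕ → (ℕ → FPS) → FPS
  prodS zero    F = oneS
  prodS (suc m) F = prodS m F ⊛ F (suc m)

  prodK : ℕ → (ℕ → Carrier) → Carrier
  prodK zero    F = 1#
  prodK (suc m) F = prodK m F * F (suc m)

  InPowℓ : ℕ → FPS → Set r
  InPowℓ ℓ f = ∀ n → ¬ (ℓ ∣ n) → f n ≈ 0#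

  InTPowℓ : ℕ → FPS → Set r
  InTPowℓ ℓ f = (f 0 ≈ 0#) × InPowℓ ℓ (shift 1 f)
    where open import Data.Product using (_×_)

  IsCompInverse : FPS → FPS → Set r
  IsCompInverse h hbar = (h 0 ≈ 0#) × (hbar 0 ≈ 0#) × (comp h hbar ≋ X) × (comp hbar h ≋ X)
    where open import Data.Product using (_×_)

  module MultipleAlmostRiordan (ℓ : ℕ) .{{_ : NonZero ℓ}}
                               (b g : FPS) (f : ℕ → FPS) (hbar : FPS) where

    -- exponent e_i(k) = ⌊(k-1+ℓ-i)/ℓ⌋  (used for k ≥ 1, 1 ≤ i ≤ ℓ)
    e : ℕ → ℕ → ℕ
    e i k = ((k ∸ 1) ℕ.+ (ℓ ∸ i)) / ℓ

    colD : ℕ → FPS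
    colD zero        = b
    colD k@(suc _)   = X ⊛ g ⊛ prodS ℓ (λ i → pow (f i) (e i k))

    d : ℕ → ℕ → Carrier
    d n k = colD k n

    b₀ g₀ w₀ : Carrier
    b₀ = b 0
    g₀ = g 0
    w₀ = b ℓ * inv b₀

    cst : ℕ → Carrier
    cst m = g₀ * prodK m (λ i → f i 1)

    -- u = hbar / t ; so hbar^ℓ = t^ℓ u^ℓ and t^ℓ / hbar^ℓ = u^{-ℓ}
    u : FPS
    u = shift 1 hbar

    uInvℓ : FPS
    uInvℓ = invS (pow u ℓ)

    -- F_i = f_i / t, so f_i(hbar) = hbar · F_i(hbar)
    Fh : ℕ → FPS
    Fh i = comp (shift 1 (f i)) hbar

    gh bh : FPS
    gh = comp g hbar
    bh = comp b hbar

    Aser : FPS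
    Aser = uInvℓ

    -- Z_m(t) = hbar^{-ℓ} (1 - g₀ f_{1,1}⋯f_{m-1,1} hbar^{m-1} / (g(hbar) f₁(hbar)⋯f_{m-1}(hbar))),  1 ≤ m ≤ ℓ-1
    Zser : ℕ → FPS
    Zser m = uInvℓ ⊛ shift ℓ (oneS ⊖ scale (cst (m ∸ 1)) (invS (gh ⊛ prodS (m ∸ 1) Fh)))

    -- Z_ℓ(t) = c/b₀ + t^ℓ/hbar^ℓ - c b(hbar) f_ℓ(hbar) / (b₀ hbar g(hbar)),  c = g₀ f_{1,1}⋯f_{ℓ-1,1}
    Zℓser : FPS
    Zℓser = const (cst (ℓ ∸ 1) * inv b₀) ⊕ uInvℓ
            ⊖ scale (cst (ℓ ∸ 1) * inv b₀) (bh ⊛ Fh ℓ ⊛ invS gh)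

    -- W(t) = f_ℓ(hbar)((1 - w₀ hbar^ℓ) b(hbar) - b₀) / (hbar^{ℓ+1} g(hbar)) + w₀
    Wser : FPS
    Wser = Fh ℓ ⊛ invS gh ⊛ uInvℓ
             ⊛ shift ℓ ((oneS ⊖ scale w₀ (pow hbar ℓ)) ⊛ bh ⊖ const b₀)
           ⊕ const w₀

    colP : ℕ → FPS
    colP zero = Wser
    colP k@(suc _) =
      if k <ᵇ ℓ then mono k ⊛ Zser k
      else if k ≡ᵇ ℓ then Zℓser
      else mono (k ∸ ℓ) ⊛ Aser

    P : ℕ → ℕ → Carrier
    P n k = colP k n

  -- P is a production matrix of the lower triangular matrix D (step ℓ):
  -- (D P)_{n,k} = d_{n+ℓ,k}; the row-by-column sum is finite as d_{n,j} = 0 for j > n.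
  IsProductionMatrix : ℕ → (ℕ → ℕ → Carrier) → (ℕ → ℕ → Carrier) → Set r
  IsProductionMatrix ℓ D P = ∀ n k → Σ≤ n (λ j → D n j * P j k) ≈ D (n ℕ.+ ℓ) k

module Submission where

-- Write f_i = t (f_i/t) and h = t (h/t). Then h^ℓ = f₁⋯f_ℓ says (h/t)^ℓ = (f₁/t)⋯(f_ℓ/t), and the
-- columns of D satisfy col_{k+ℓ} = col_k f₁⋯f_ℓ = col_k h^ℓ. Consequently, for Z ∈ K[[t^ℓ]], the row
-- sums of D against the column t^k Z are the coefficients of col_k Z(h), shifted by ℓ; every column
-- of P is then verified by substituting h into its generating function and using h̄(h) = t.
-- This needs all series to stay in K[[t^ℓ]] under substitution of h and h̄. In characteristic 0,
-- (h/t)^ℓ ∈ K[[t^ℓ]] with nonzero constant term forces h/t ∈ K[[t^ℓ]], so h ∈ t K[[t^ℓ]], and then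
-- also h̄ ∈ t K[[t^ℓ]]. Columns 0 and ℓ, which involve b, reduce to a series identity after
-- multiplication by the unit f_ℓ/t.

open import Defs
open import Level using (Level)
open import Data.Nat using (ℕ; _≤_; NonZero)
open import Data.Product using (_×_)
open import Relation.Nullary using (¬_)
open import Algebra.Bundles using (CommutativeRing)
open import Data.Nat using (zero; suc; _<_; z≤n; s≤s)

-- The standard library's ring solvers need a zero test on coefficients, which the elements of an
-- abstract commutative ring lack; integer coefficients have one. The TC-optimised multiple ×′
-- makes ⟦ + 1 ⟧ℤ definitionally 1#, so that con (+ 1) matches 1# and oneS in goals.
module IntegerRingSolver {c r} (R : CommutativeRing c r) where

  open import Data.Nat as ℕ using (ℕ; zero; suc)
  open import Data.Integer as ℤ using (ℤ; +_; -[1+_])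
  import Data.Integer.Properties as ℤP
  import Data.Nat.Properties as ℕP
  open import Data.Sign as Sign using (Sign)
  open import Data.Maybe using (Maybe; just; nothing)
  import Relation.Binary.PropositionalEquality as ≡
  open import Relation.Nullary using (yes; no)
  open import Algebra.Solver.Ring.AlmostCommutativeRing
    using (fromCommutativeRing; _-Raw-AlmostCommutative⟶_)
  open CommutativeRing R
  open import Relation.Binary.Reasoning.Setoid setoid
  open import Algebra.Properties.Ring ring
    using (-0#≈0#; -‿distribˡ-*; -‿involutive; -‿+-comm)
  open import Algebra.Properties.Semiring.Mult.TCOptimised semiring
    using (1+×; ×-homo-+; ×1-homo-*) renaming (_×_ to _×′_)
  open import Algebra.Properties.CommutativeSemigroup *-commutativeSemigroup
    using () renaming (interchange to *-interchange)
  open import Algebra.Properties.CommutativeSemigroup +-commutativeSemigroup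
    using () renaming (interchange to +-interchange)

  ⟦_⟧ℤ : ℤ → Carrier
  ⟦ + n ⟧ℤ      = n ×′ 1#
  ⟦ -[1+ n ] ⟧ℤ = - (suc n ×′ 1#)

  ⟦_⟧± : Sign → Carrier
  ⟦ Sign.+ ⟧± = 1#
  ⟦ Sign.- ⟧± = - 1#

  ⟦⟧±-* : ∀ s t → ⟦ s Sign.* t ⟧± ≈ ⟦ s ⟧± * ⟦ t ⟧±
  ⟦⟧±-* Sign.+ t      = sym (*-identityˡ _)
  ⟦⟧±-* Sign.- Sign.+ = sym (*-identityʳ _)
  ⟦⟧±-* Sign.- Sign.- = begin
    1#              ≈⟨ sym (-‿involutive _) ⟩
    - - 1#          ≈⟨ -‿cong (sym (*-identityˡ _)) ⟩
    - (1# * - 1#)   ≈⟨ -‿distribˡ-* _ _ ⟩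
    - 1# * - 1#     ∎

  ⟦⟧ℤ-◃ : ∀ s n → ⟦ s ℤ.◃ n ⟧ℤ ≈ ⟦ s ⟧± * (n ×′ 1#)
  ⟦⟧ℤ-◃ s      zero    = sym (zeroʳ _)
  ⟦⟧ℤ-◃ Sign.+ (suc n) = sym (*-identityˡ _)
  ⟦⟧ℤ-◃ Sign.- (suc n) = trans (-‿cong (sym (*-identityˡ _))) (-‿distribˡ-* _ _)

  ⟦⟧ℤ-sign-abs : ∀ i → ⟦ i ⟧ℤ ≈ ⟦ ℤ.sign i ⟧± * (ℤ.∣ i ∣ ×′ 1#)
  ⟦⟧ℤ-sign-abs (+ n)    = sym (*-identityˡ _)
  ⟦⟧ℤ-sign-abs -[1+ n ] = trans (-‿cong (sym (*-identityˡ _))) (-‿distribˡ-* _ _)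

  ⟦⟧ℤ-* : ∀ i j → ⟦ i ℤ.* j ⟧ℤ ≈ ⟦ i ⟧ℤ * ⟦ j ⟧ℤ
  ⟦⟧ℤ-* i j = begin
    ⟦ s ℤ.◃ ∣i∣ ℕ.* ∣j∣ ⟧ℤ
      ≈⟨ ⟦⟧ℤ-◃ s (∣i∣ ℕ.* ∣j∣) ⟩
    ⟦ s ⟧± * ((∣i∣ ℕ.* ∣j∣) ×′ 1#)
      ≈⟨ *-cong (⟦⟧±-* (ℤ.sign i) (ℤ.sign j)) (×1-homo-* ∣i∣ ∣j∣) ⟩
    (⟦ ℤ.sign i ⟧± * ⟦ ℤ.sign j ⟧±) * ((∣i∣ ×′ 1#) * (∣j∣ ×′ 1#))
      ≈⟨ *-interchange _ _ _ _ ⟩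
    (⟦ ℤ.sign i ⟧± * (∣i∣ ×′ 1#)) * (⟦ ℤ.sign j ⟧± * (∣j∣ ×′ 1#))
      ≈⟨ *-cong (⟦⟧ℤ-sign-abs i) (⟦⟧ℤ-sign-abs j) ⟨
    ⟦ i ⟧ℤ * ⟦ j ⟧ℤ
      ∎
    where
    s : Sign
    s = ℤ.sign i Sign.* ℤ.sign j
    ∣i∣ : ℕ
    ∣i∣ = ℤ.∣ i ∣
    ∣j∣ : ℕ
    ∣j∣ = ℤ.∣ j ∣

  ⟦⟧ℤ-⊖ : ∀ m n → ⟦ m ℤ.⊖ n ⟧ℤ ≈ m ×′ 1# - n ×′ 1#
  ⟦⟧ℤ-⊖ m       zero    = begin
    ⟦ m ℤ.⊖ 0 ⟧ℤ   ≡⟨ ≡.cong ⟦_⟧ℤ (ℤP.⊖-≥ {m} ℕ.z≤n) ⟩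
    m ×′ 1#         ≈⟨ +-identityʳ _ ⟨
    m ×′ 1# + 0#    ≈⟨ +-congˡ -0#≈0# ⟨
    m ×′ 1# - 0#    ∎
  ⟦⟧ℤ-⊖ zero    (suc n) = sym (+-identityˡ _)
  ⟦⟧ℤ-⊖ (suc m) (suc n) = begin
    ⟦ suc m ℤ.⊖ suc n ⟧ℤ         ≡⟨ ≡.cong ⟦_⟧ℤ (ℤP.[1+m]⊖[1+n]≡m⊖n m n) ⟩
    ⟦ m ℤ.⊖ n ⟧ℤ                 ≈⟨ ⟦⟧ℤ-⊖ m n ⟩
    x - y                         ≈⟨ +-identityˡ _ ⟨
    0# + (x - y)                  ≈⟨ +-congʳ (-‿inverseʳ 1#) ⟨
    (1# - 1#) + (x - y)           ≈⟨ +-interchange _ _ _ _ ⟩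
    (1# + x) + (- 1# - y)         ≈⟨ +-congˡ (-‿+-comm _ _) ⟩
    (1# + x) - (1# + y)           ≈⟨ +-cong (1+× m 1#) (-‿cong (1+× n 1#)) ⟨
    suc m ×′ 1# - suc n ×′ 1#     ∎
    where
    x : Carrier
    x = m ×′ 1#
    y : Carrier
    y = n ×′ 1#

  ⟦⟧ℤ-+ : ∀ i j → ⟦ i ℤ.+ j ⟧ℤ ≈ ⟦ i ⟧ℤ + ⟦ j ⟧ℤ
  ⟦⟧ℤ-+ (+ m)     (+ n)     = ×-homo-+ 1# m n
  ⟦⟧ℤ-+ (+ m)     -[1+ n ]  = ⟦⟧ℤ-⊖ m (suc n)
  ⟦⟧ℤ-+ -[1+ m ]  (+ n)     = trans (⟦⟧ℤ-⊖ n (suc m)) (+-comm _ _)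
  ⟦⟧ℤ-+ -[1+ m ]  -[1+ n ]  = begin
    - (suc (suc m ℕ.+ n) ×′ 1#)        ≡⟨ ≡.cong (λ k → - (k ×′ 1#)) (ℕP.+-suc (suc m) n) ⟨
    - ((suc m ℕ.+ suc n) ×′ 1#)        ≈⟨ -‿cong (×-homo-+ 1# (suc m) (suc n)) ⟩
    - (suc m ×′ 1# + suc n ×′ 1#)      ≈⟨ -‿+-comm _ _ ⟨
    - (suc m ×′ 1#) - (suc n ×′ 1#)    ∎

  ⟦⟧ℤ-neg : ∀ i → ⟦ ℤ.- i ⟧ℤ ≈ - ⟦ i ⟧ℤ
  ⟦⟧ℤ-neg (+ zero)  = sym -0#≈0#
  ⟦⟧ℤ-neg (+ suc n) = refl
  ⟦⟧ℤ-neg -[1+ n ]  = sym (-‿involutive _)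

  integerMorphism : ℤ.+-*-rawRing -Raw-AlmostCommutative⟶ fromCommutativeRing R
  integerMorphism = record
    { ⟦_⟧ = ⟦_⟧ℤ ; +-homo = ⟦⟧ℤ-+ ; *-homo = ⟦⟧ℤ-* ; -‿homo = ⟦⟧ℤ-neg
    ; 0-homo = refl ; 1-homo = refl }

  _ℤ≟_ : ∀ i j → Maybe (⟦ i ⟧ℤ ≈ ⟦ j ⟧ℤ)
  i ℤ≟ j with i ℤ.≟ j
  ... | yes ≡.refl = just refl
  ... | no _       = nothing

  open import Algebra.Solver.Ring ℤ.+-*-rawRing (fromCommutativeRing R) integerMorphism _ℤ≟_
    public using (solve; _:=_; _:+_; _:-_; _:*_; con)


module FiniteSums {a r} (R : CommutativeRing a r)
                  (inv : CommutativeRing.Carrier R → CommutativeRing.Carrier R) where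

  open import Data.Nat as ℕ using (ℕ; zero; suc; _∸_; _≤_; _<_; z≤n; s≤s)
  import Data.Nat.Properties as ℕP
  open import Data.Sum using (inj₁; inj₂)
  open import Function using (_∘_)
  open import Relation.Binary.PropositionalEquality as ≡ using (_≡_; _≢_)
  open CommutativeRing R
  open Series R inv
  open import Relation.Binary.Reasoning.Setoid setoid
  open import Algebra.Properties.Ring ring using (-‿+-comm)
  open import Algebra.Properties.CommutativeSemigroup +-commutativeSemigroup
    using () renaming (interchange to +-interchange; xy∙z≈xz∙y to x+y+z≈x+z+y)

  Σ≤-cong-≤ : ∀ n {F G : ℕ → Carrier} → (∀ i → i ≤ n → F i ≈ G i) → Σ≤ n F ≈ Σ≤ n G
  Σ≤-cong-≤ zero    F≈G = F≈G 0 z≤n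
  Σ≤-cong-≤ (suc n) F≈G =
    +-cong (Σ≤-cong-≤ n (λ i i≤n → F≈G i (ℕP.m≤n⇒m≤1+n i≤n))) (F≈G (suc n) ℕP.≤-refl)

  Σ≤-cong : ∀ n {F G : ℕ → Carrier} → (∀ i → F i ≈ G i) → Σ≤ n F ≈ Σ≤ n G
  Σ≤-cong n F≈G = Σ≤-cong-≤ n (λ i _ → F≈G i)

  Σ≤-distrib-+ : ∀ n (F G : ℕ → Carrier) → Σ≤ n (λ i → F i + G i) ≈ Σ≤ n F + Σ≤ n G
  Σ≤-distrib-+ zero    F G = refl
  Σ≤-distrib-+ (suc n) F G = begin
    Σ≤ n (λ i → F i + G i) + (F (suc n) + G (suc n)) ≈⟨ +-congʳ (Σ≤-distrib-+ n F G) ⟩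
    (Σ≤ n F + Σ≤ n G) + (F (suc n) + G (suc n))      ≈⟨ +-interchange _ _ _ _ ⟩
    (Σ≤ n F + F (suc n)) + (Σ≤ n G + G (suc n))      ∎

  *-distribˡ-Σ≤ : ∀ n c (F : ℕ → Carrier) → c * Σ≤ n F ≈ Σ≤ n (λ i → c * F i)
  *-distribˡ-Σ≤ zero    c F = refl
  *-distribˡ-Σ≤ (suc n) c F = trans (distribˡ _ _ _) (+-congʳ (*-distribˡ-Σ≤ n c F))

  *-distribʳ-Σ≤ : ∀ n c (F : ℕ → Carrier) → Σ≤ n F * c ≈ Σ≤ n (λ i → F i * c)
  *-distribʳ-Σ≤ zero    c F = refl
  *-distribʳ-Σ≤ (suc n) c F = trans (distribʳ _ _ _) (+-congʳ (*-distribʳ-Σ≤ n c F))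

  -‿distrib-Σ≤ : ∀ n (F : ℕ → Carrier) → - Σ≤ n F ≈ Σ≤ n (λ i → - F i)
  -‿distrib-Σ≤ zero    F = refl
  -‿distrib-Σ≤ (suc n) F = trans (sym (-‿+-comm _ _)) (+-congʳ (-‿distrib-Σ≤ n F))

  Σ≤-product : ∀ n m (F G : ℕ → Carrier) → Σ≤ n F * Σ≤ m G ≈ Σ≤ n (λ i → Σ≤ m (λ j → F i * G j))
  Σ≤-product n m F G = trans (*-distribʳ-Σ≤ n _ F) (Σ≤-cong n (λ i → *-distribˡ-Σ≤ m (F i) G))

  Σ≤-zero : ∀ n (F : ℕ → Carrier) → (∀ i → i ≤ n → F i ≈ 0#) → Σ≤ n F ≈ 0#
  Σ≤-zero zero    F F≈0 = F≈0 0 z≤n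
  Σ≤-zero (suc n) F F≈0 =
    trans (+-cong (Σ≤-zero n F (λ i i≤n → F≈0 i (ℕP.m≤n⇒m≤1+n i≤n))) (F≈0 (suc n) ℕP.≤-refl)) (+-identityʳ _)

  Σ≤-suc : ∀ n (F : ℕ → Carrier) → Σ≤ (suc n) F ≈ F 0 + Σ≤ n (F ∘ suc)
  Σ≤-suc zero    F = refl
  Σ≤-suc (suc n) F = trans (+-congʳ (Σ≤-suc n F)) (+-assoc _ _ _)

  Σ≤-head : ∀ n (F : ℕ → Carrier) → (∀ i → F (suc i) ≈ 0#) → Σ≤ n F ≈ F 0
  Σ≤-head zero    F _   = refl
  Σ≤-head (suc n) F F≈0 = trans (Σ≤-suc n F) (trans (+-congˡ (Σ≤-zero n _ (λ i _ → F≈0 i))) (+-identityʳ _))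

  Σ≤-drop : ∀ s n (F : ℕ → Carrier) → s ≤ n → (∀ j → j < s → F j ≈ 0#) →
            Σ≤ n F ≈ Σ≤ (n ∸ s) (λ i → F (s ℕ.+ i))
  Σ≤-drop zero    n       F _         _   = refl
  Σ≤-drop (suc s) (suc n) F (s≤s s≤n) F≈0 = begin
    Σ≤ (suc n) F                          ≈⟨ Σ≤-suc n F ⟩
    F 0 + Σ≤ n (F ∘ suc)                  ≈⟨ +-congʳ (F≈0 0 (s≤s z≤n)) ⟩
    0# + Σ≤ n (F ∘ suc)                   ≈⟨ +-identityˡ _ ⟩
    Σ≤ n (F ∘ suc)                        ≈⟨ Σ≤-drop s n (F ∘ suc) s≤n (λ j j<s → F≈0 (suc j) (s≤s j<s)) ⟩
    Σ≤ (n ∸ s) (λ i → F (suc s ℕ.+ i))    ∎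

  Σ≤-extend : ∀ m n (F : ℕ → Carrier) → m ≤ n → (∀ i → m < i → i ≤ n → F i ≈ 0#) → Σ≤ n F ≈ Σ≤ m F
  Σ≤-extend m n F m≤n F≈0 with ℕP.m≤n⇒m<n∨m≡n m≤n
  ... | inj₂ ≡.refl = refl
  Σ≤-extend m (suc n) F _ F≈0 | inj₁ (s≤s m≤n) =
    trans (+-cong (Σ≤-extend m n F m≤n (λ i m<i i≤n → F≈0 i m<i (ℕP.m≤n⇒m≤1+n i≤n)))
                  (F≈0 (suc n) (s≤s m≤n) ℕP.≤-refl))
          (+-identityʳ _)

  Σ≤-last : ∀ n (F : ℕ → Carrier) → (∀ i → i < n → F i ≈ 0#) → Σ≤ n F ≈ F n
  Σ≤-last zero    F _   = refl
  Σ≤-last (suc n) F F≈0 = trans (+-congʳ (Σ≤-zero n F (λ i i≤n → F≈0 i (s≤s i≤n)))) (+-identityˡ _)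

  Σ≤-single : ∀ n p (F : ℕ → Carrier) → p ≤ n → (∀ i → i ≤ n → i ≢ p → F i ≈ 0#) → Σ≤ n F ≈ F p
  Σ≤-single n p F p≤n F≈0 = trans
    (Σ≤-extend p n F p≤n (λ i p<i i≤n → F≈0 i i≤n (ℕP.>⇒≢ p<i)))
    (Σ≤-last p F (λ i i<p → F≈0 i (ℕP.≤-trans (ℕP.<⇒≤ i<p) p≤n) (ℕP.<⇒≢ i<p)))

  Σ≤-reverse : ∀ n (F : ℕ → Carrier) → Σ≤ n F ≈ Σ≤ n (λ i → F (n ∸ i))
  Σ≤-reverse zero    F = refl
  Σ≤-reverse (suc n) F = begin
    Σ≤ (suc n) F
      ≈⟨ Σ≤-suc n F ⟩
    F 0 + Σ≤ n (F ∘ suc)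
      ≈⟨ +-congˡ (Σ≤-reverse n (F ∘ suc)) ⟩
    F 0 + Σ≤ n (λ i → F (suc (n ∸ i)))
      ≈⟨ +-comm _ _ ⟩
    Σ≤ n (λ i → F (suc (n ∸ i))) + F 0
      ≈⟨ +-cong (Σ≤-cong-≤ n (λ i i≤n → reflexive (≡.cong F (ℕP.+-∸-assoc 1 i≤n))))
         (reflexive (≡.cong F (ℕP.n∸n≡0 n))) ⟨
    Σ≤ n (λ i → F (suc n ∸ i)) + F (suc n ∸ suc n)        ∎

  Σ≤-swap : ∀ n m (F : ℕ → ℕ → Carrier) → Σ≤ n (λ i → Σ≤ m (F i)) ≈ Σ≤ m (λ j → Σ≤ n (λ i → F i j))
  Σ≤-swap zero    m F = refl
  Σ≤-swap (suc n) m F = trans (+-congʳ (Σ≤-swap n m F)) (sym (Σ≤-distrib-+ m _ _))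

  Σ≤-triangle : ∀ n (F : ℕ → ℕ → Carrier) →
    Σ≤ n (λ i → Σ≤ i (λ a → F a i)) ≈ Σ≤ n (λ a → Σ≤ (n ∸ a) (λ j → F a (a ℕ.+ j)))
  Σ≤-triangle zero    F = refl
  Σ≤-triangle (suc n) F = begin
    Σ≤ n (λ i → Σ≤ i (λ a → F a i)) + Σ≤ (suc n) (λ a → F a (suc n))
      ≈⟨ +-congʳ (Σ≤-triangle n F) ⟩
    U + (Σ≤ n (λ a → F a (suc n)) + F (suc n) (suc n))
      ≈⟨ sym (+-assoc _ _ _) ⟩
    (U + Σ≤ n (λ a → F a (suc n))) + F (suc n) (suc n)
      ≈⟨ +-congʳ (sym (Σ≤-distrib-+ n _ _)) ⟩
    Σ≤ n (λ a → Σ≤ (n ∸ a) (λ j → F a (a ℕ.+ j)) + F a (suc n)) + F (suc n) (suc n)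
      ≈⟨ +-cong (Σ≤-cong-≤ n row) (reflexive corner) ⟩
    Σ≤ n (λ a → Σ≤ (suc n ∸ a) (λ j → F a (a ℕ.+ j))) + Σ≤ (suc n ∸ suc n) (λ j → F (suc n) (suc n ℕ.+ j))
      ∎
    where
    U : Carrier
    U = Σ≤ n (λ a → Σ≤ (n ∸ a) (λ j → F a (a ℕ.+ j)))
    corner : F (suc n) (suc n) ≡ Σ≤ (n ∸ n) (λ j → F (suc n) (suc n ℕ.+ j))
    corner = ≡.trans (≡.cong (F (suc n)) (≡.sym (ℕP.+-identityʳ (suc n))))
                     (≡.cong (λ k → Σ≤ k (λ j → F (suc n) (suc n ℕ.+ j))) (≡.sym (ℕP.n∸n≡0 n)))
    row : ∀ a → a ≤ n → Σ≤ (n ∸ a) (λ j → F a (a ℕ.+ j)) + F a (suc n) ≈ Σ≤ (suc n ∸ a) (λ j → F a (a ℕ.+ j))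
    row a a≤n = reflexive (≡.trans
      (≡.cong (λ x → Σ≤ (n ∸ a) (λ j → F a (a ℕ.+ j)) + F a x)
              (≡.sym (≡.trans (ℕP.+-suc a (n ∸ a)) (≡.cong suc (ℕP.m+[n∸m]≡n a≤n)))))
      (≡.cong (λ k → Σ≤ k (λ j → F a (a ℕ.+ j))) (≡.sym (ℕP.+-∸-assoc 1 a≤n))))

  Σ≤-agree-off-0 : ∀ N (F G : ℕ → Carrier) → (∀ i → 1 ≤ i → i ≤ N → F i ≈ G i) →
                   Σ≤ N F ≈ Σ≤ N G + (F 0 - G 0)
  Σ≤-agree-off-0 zero    F G _   = solve 2 (λ x y → x := y :+ (x :- y)) refl (F 0) (G 0)
    where open IntegerRingSolver R
  Σ≤-agree-off-0 (suc N) F G F≈G = begin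
    Σ≤ N F + F (suc N)
      ≈⟨ +-cong (Σ≤-agree-off-0 N F G (λ i 1≤i i≤N → F≈G i 1≤i (ℕP.m≤n⇒m≤1+n i≤N)))
         (F≈G (suc N) (s≤s z≤n) ℕP.≤-refl) ⟩
    (Σ≤ N G + (F 0 - G 0)) + G (suc N)
      ≈⟨ x+y+z≈x+z+y _ _ _ ⟩
    (Σ≤ N G + G (suc N)) + (F 0 - G 0)      ∎

module PowerSeriesRing {a r} (R : CommutativeRing a r)
                       (inv : CommutativeRing.Carrier R → CommutativeRing.Carrier R) where

  open import Data.Nat as ℕ using (ℕ; zero; suc; _∸_; _≤_; _<_; z≤n; s≤s)
  open import Relation.Nullary using (yes; no; contradiction)
  open import Function using (_∘_)
  import Data.Nat.Properties as ℕP
  open import Data.Product using (_,_)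
  open import Data.Sum using (inj₁; inj₂)
  open import Relation.Binary.PropositionalEquality as ≡ using (_≡_; _≢_)
  open import Relation.Binary.Structures using (IsEquivalence)
  open CommutativeRing R
  open Series R inv public renaming (_≋_ to infix 4 _≋_)
  open FiniteSums R inv
  import Relation.Binary.Reasoning.Setoid as SetoidReasoning
  module ≈-Reasoning = SetoidReasoning setoid
  open import Algebra.Properties.Ring ring using (-0#≈0#)

  ≋-refl : ∀ {f} → f ≋ f
  ≋-refl n = refl

  ≋-sym : ∀ {f g} → f ≋ g → g ≋ f
  ≋-sym f≋g n = sym (f≋g n)

  ≋-trans : ∀ {f g h} → f ≋ g → g ≋ h → f ≋ h
  ≋-trans f≋g g≋h n = trans (f≋g n) (g≋h n)

  ≡⇒≋ : ∀ {f g} → f ≡ g → f ≋ g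
  ≡⇒≋ ≡.refl = ≋-refl

  ≋-isEquivalence : IsEquivalence _≋_
  ≋-isEquivalence = record { refl = ≋-refl ; sym = ≋-sym ; trans = ≋-trans }

  negS : FPS → FPS
  negS f n = - f n

  ⊕-cong : ∀ {f f′ g g′} → f ≋ f′ → g ≋ g′ → f ⊕ g ≋ f′ ⊕ g′
  ⊕-cong f≋f′ g≋g′ n = +-cong (f≋f′ n) (g≋g′ n)

  ⊖-cong : ∀ {f f′ g g′} → f ≋ f′ → g ≋ g′ → f ⊖ g ≋ f′ ⊖ g′
  ⊖-cong f≋f′ g≋g′ n = +-cong (f≋f′ n) (-‿cong (g≋g′ n))

  ⊛-cong : ∀ {f f′ g g′} → f ≋ f′ → g ≋ g′ → f ⊛ g ≋ f′ ⊛ g′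
  ⊛-cong f≋f′ g≋g′ n = Σ≤-cong n (λ i → *-cong (f≋f′ i) (g≋g′ (n ∸ i)))

  ⊛-congˡ : ∀ f {g g′} → g ≋ g′ → f ⊛ g ≋ f ⊛ g′
  ⊛-congˡ f = ⊛-cong {f} {f} ≋-refl

  ⊛-congʳ : ∀ {f f′} g → f ≋ f′ → f ⊛ g ≋ f′ ⊛ g
  ⊛-congʳ g f≋f′ = ⊛-cong f≋f′ (≋-refl {g})

  ⊛-comm : ∀ f g → f ⊛ g ≋ g ⊛ f
  ⊛-comm f g n = trans (Σ≤-reverse n _) (Σ≤-cong-≤ n (λ i i≤n →
    trans (*-comm _ _) (*-congʳ (reflexive (≡.cong g (ℕP.m∸[m∸n]≡n i≤n))))))

  ⊛-assoc : ∀ f g h → (f ⊛ g) ⊛ h ≋ f ⊛ (g ⊛ h)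
  ⊛-assoc f g h n = begin
    Σ≤ n (λ i → Σ≤ i (λ a → f a * g (i ∸ a)) * h (n ∸ i))
      ≈⟨ Σ≤-cong n (λ i → *-distribʳ-Σ≤ i _ _) ⟩
    Σ≤ n (λ i → Σ≤ i (λ a → f a * g (i ∸ a) * h (n ∸ i)))
      ≈⟨ Σ≤-triangle n (λ a i → f a * g (i ∸ a) * h (n ∸ i)) ⟩
    Σ≤ n (λ a → Σ≤ (n ∸ a) (λ j → f a * g ((a ℕ.+ j) ∸ a) * h (n ∸ (a ℕ.+ j))))
      ≈⟨ Σ≤-cong n (λ a → Σ≤-cong (n ∸ a) (λ j → trans (*-assoc _ _ _) (*-congˡ (reflexive
           (≡.cong₂ (λ x y → g x * h y) (ℕP.m+n∸m≡n a j) (≡.sym (ℕP.∸-+-assoc n a j))))))) ⟩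
    Σ≤ n (λ a → Σ≤ (n ∸ a) (λ j → f a * (g j * h ((n ∸ a) ∸ j))))
      ≈⟨ Σ≤-cong n (λ a → sym (*-distribˡ-Σ≤ (n ∸ a) _ _)) ⟩
    Σ≤ n (λ a → f a * Σ≤ (n ∸ a) (λ j → g j * h ((n ∸ a) ∸ j)))
      ∎
    where open ≈-Reasoning

  ⊛-distribˡ : ∀ f g h → f ⊛ (g ⊕ h) ≋ f ⊛ g ⊕ f ⊛ h
  ⊛-distribˡ f g h n = trans (Σ≤-cong n (λ i → distribˡ _ _ _)) (Σ≤-distrib-+ n _ _)

  ⊛-distribʳ : ∀ f g h → (g ⊕ h) ⊛ f ≋ g ⊛ f ⊕ h ⊛ f
  ⊛-distribʳ f g h n = trans (Σ≤-cong n (λ i → distribʳ _ _ _)) (Σ≤-distrib-+ n _ _)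

  ⊛-identityˡ : ∀ f → oneS ⊛ f ≋ f
  ⊛-identityˡ f n = trans (Σ≤-head n _ (λ i → zeroˡ _)) (*-identityˡ _)

  ⊛-identityʳ : ∀ f → f ⊛ oneS ≋ f
  ⊛-identityʳ f = ≋-trans (⊛-comm f oneS) (⊛-identityˡ f)

  seriesRing : CommutativeRing a r
  seriesRing = record
    { Carrier = FPS ; _≈_ = _≋_ ; _+_ = _⊕_ ; _*_ = _⊛_ ; -_ = negS ; 0# = zeroS ; 1# = oneS
    ; isCommutativeRing = record
      { isRing = record
        { +-isAbelianGroup = record
          { isGroup = record
            { isMonoid = record
              { isSemigroup = record
                { isMagma = record { isEquivalence = ≋-isEquivalence ; ∙-cong = ⊕-cong }
                ; assoc = λ f g h n → +-assoc _ _ _ }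
              ; identity = (λ f n → +-identityˡ _) , (λ f n → +-identityʳ _) }
            ; inverse = (λ f n → -‿inverseˡ _) , (λ f n → -‿inverseʳ _)
            ; ⁻¹-cong = λ f≋g n → -‿cong (f≋g n) }
          ; comm = λ f g n → +-comm _ _ }
        ; *-cong = ⊛-cong
        ; *-assoc = ⊛-assoc
        ; *-identity = ⊛-identityˡ , ⊛-identityʳ
        ; distrib = ⊛-distribˡ , ⊛-distribʳ }
      ; *-comm = ⊛-comm } }

  module SeriesSolver = IntegerRingSolver seriesRing
  module ≋-Reasoning = SetoidReasoning (CommutativeRing.setoid seriesRing)

  const⊛ : ∀ c f → const c ⊛ f ≋ scale c f
  const⊛ c f n = Σ≤-head n _ (λ i → zeroˡ _)

  scale-cong : ∀ {c d f g} → c ≈ d → f ≋ g → scale c f ≋ scale d g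
  scale-cong c≈d f≋g n = *-cong c≈d (f≋g n)

  const-cong : ∀ {c d} → c ≈ d → const c ≋ const d
  const-cong c≈d zero    = c≈d
  const-cong c≈d (suc n) = refl

  const-≢0 : ∀ c n → n ≢ 0 → const c n ≈ 0#
  const-≢0 c zero    n≢0 = contradiction ≡.refl n≢0
  const-≢0 c (suc n) _   = refl

  const-1# : const 1# ≋ oneS
  const-1# zero    = refl
  const-1# (suc n) = refl

  shift-cong : ∀ k {f g} → f ≋ g → shift k f ≋ shift k g
  shift-cong k f≋g n = f≋g (n ℕ.+ k)

  mono-diagonal : ∀ k → mono k k ≈ 1#
  mono-diagonal zero    = refl
  mono-diagonal (suc k) = mono-diagonal k

  mono-offDiagonal : ∀ k n → n ≢ k → mono k n ≈ 0#
  mono-offDiagonal zero    zero    n≢k = contradiction ≡.refl n≢k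
  mono-offDiagonal zero    (suc n) _   = refl
  mono-offDiagonal (suc k) zero    _   = refl
  mono-offDiagonal (suc k) (suc n) n≢k = mono-offDiagonal k n (n≢k ∘ ≡.cong suc)

  mono-zero-⊛ : ∀ f → mono 0 ⊛ f ≋ f
  mono-zero-⊛ f n = trans (Σ≤-head n _ (λ i → zeroˡ _)) (*-identityˡ _)

  mono-suc-⊛-zero : ∀ k f → (mono (suc k) ⊛ f) 0 ≈ 0#
  mono-suc-⊛-zero k f = zeroˡ _

  mono-suc-⊛-suc : ∀ k f n → (mono (suc k) ⊛ f) (suc n) ≈ (mono k ⊛ f) n
  mono-suc-⊛-suc k f n = trans (Σ≤-suc n _) (trans (+-congʳ (zeroˡ _)) (+-identityˡ _))

  mono-⊛-+ : ∀ k f n → (mono k ⊛ f) (n ℕ.+ k) ≈ f n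
  mono-⊛-+ zero    f n = trans (reflexive (≡.cong (mono 0 ⊛ f) (ℕP.+-identityʳ n))) (mono-zero-⊛ f n)
  mono-⊛-+ (suc k) f n = begin
    (mono (suc k) ⊛ f) (n ℕ.+ suc k)  ≡⟨ ≡.cong (mono (suc k) ⊛ f) (ℕP.+-suc n k) ⟩
    (mono (suc k) ⊛ f) (suc (n ℕ.+ k)) ≈⟨ mono-suc-⊛-suc k f (n ℕ.+ k) ⟩
    (mono k ⊛ f) (n ℕ.+ k)            ≈⟨ mono-⊛-+ k f n ⟩
    f n                               ∎
    where open ≈-Reasoning

  mono-⊛-< : ∀ k f n → n < k → (mono k ⊛ f) n ≈ 0#
  mono-⊛-< (suc k) f zero    _         = mono-suc-⊛-zero k f
  mono-⊛-< (suc k) f (suc n) (s≤s n<k) = trans (mono-suc-⊛-suc k f n) (mono-⊛-< k f n n<k)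

  shift-mono-⊛ : ∀ k f → shift k (mono k ⊛ f) ≋ f
  shift-mono-⊛ k f n = mono-⊛-+ k f n

  mono-⊛-injective : ∀ k {f g} → mono k ⊛ f ≋ mono k ⊛ g → f ≋ g
  mono-⊛-injective k {f} {g} eq =
    ≋-trans (≋-sym (shift-mono-⊛ k f)) (≋-trans (shift-cong k eq) (shift-mono-⊛ k g))

  mono-suc : ∀ k f → mono (suc k) ⊛ f ≋ X ⊛ (mono k ⊛ f)
  mono-suc k f zero    = trans (mono-suc-⊛-zero k f) (sym (mono-suc-⊛-zero 0 (mono k ⊛ f)))
  mono-suc k f (suc n) = begin
    (mono (suc k) ⊛ f) (suc n)  ≈⟨ mono-suc-⊛-suc k f n ⟩
    (mono k ⊛ f) n              ≈⟨ sym (mono-zero-⊛ (mono k ⊛ f) n) ⟩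
    (mono 0 ⊛ (mono k ⊛ f)) n   ≈⟨ sym (mono-suc-⊛-suc 0 (mono k ⊛ f) n) ⟩
    (X ⊛ (mono k ⊛ f)) (suc n)  ∎
    where open ≈-Reasoning

  X⊛mono : ∀ k → X ⊛ mono k ≋ mono (suc k)
  X⊛mono k = ≋-trans (⊛-congˡ X (≋-sym (⊛-identityʳ (mono k))))
             (≋-trans (≋-sym (mono-suc k oneS)) (⊛-identityʳ (mono (suc k))))

  Ord≥ : ℕ → FPS → Set r
  Ord≥ k f = ∀ n → n < k → f n ≈ 0#

  Ord≥-cong : ∀ {k f g} → f ≋ g → Ord≥ k f → Ord≥ k g
  Ord≥-cong f≋g f≥k n n<k = trans (sym (f≋g n)) (f≥k n n<k)

  Ord≥-mono-⊛ : ∀ k f → Ord≥ k (mono k ⊛ f)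
  Ord≥-mono-⊛ = mono-⊛-<

  Ord≥-⊛ : ∀ {j k f g} → Ord≥ j f → Ord≥ k g → Ord≥ (j ℕ.+ k) (f ⊛ g)
  Ord≥-⊛ {j} {k} {f} {g} f≥j g≥k n n<j+k = Σ≤-zero n _ term
    where
    term : ∀ i → i ≤ n → f i * g (n ∸ i) ≈ 0#
    term i i≤n with i ℕ.<? j
    ... | yes i<j = trans (*-congʳ (f≥j i i<j)) (zeroˡ _)
    ... | no  i≮j = trans (*-congˡ (g≥k (n ∸ i) n∸i<k)) (zeroʳ _)
      where
      n∸i<k : n ∸ i < k
      n∸i<k = ℕP.+-cancelˡ-< i (n ∸ i) k (ℕP.<-≤-trans
        (≡.subst (_< j ℕ.+ k) (≡.sym (ℕP.m+[n∸m]≡n i≤n)) n<j+k) (ℕP.+-monoˡ-≤ k (ℕP.≮⇒≥ i≮j)))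

  Ord≥⇒≋mono⊛shift : ∀ k f → Ord≥ k f → f ≋ mono k ⊛ shift k f
  Ord≥⇒≋mono⊛shift zero    f _   = ≋-sym (≋-trans (mono-zero-⊛ _) (λ n → reflexive (≡.cong f (ℕP.+-identityʳ n))))
  Ord≥⇒≋mono⊛shift (suc k) f f≥k = coeff
    where
    g = shift 1 f
    g≥k : Ord≥ k g
    g≥k n n<k = trans (reflexive (≡.cong f (ℕP.+-comm n 1))) (f≥k (suc n) (s≤s n<k))
    shift-shift : shift k g ≋ shift (suc k) f
    shift-shift n = reflexive (≡.cong f (≡.trans (ℕP.+-assoc n k 1) (≡.cong (n ℕ.+_) (ℕP.+-comm k 1))))
    coeff : ∀ n → f n ≈ (mono (suc k) ⊛ shift (suc k) f) n
    coeff zero    = trans (f≥k 0 (s≤s z≤n)) (sym (mono-suc-⊛-zero k (shift (suc k) f)))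
    coeff (suc n) = begin
      f (suc n)                                 ≡⟨ ≡.cong f (ℕP.+-comm 1 n) ⟩
      g n                                       ≈⟨ Ord≥⇒≋mono⊛shift k g g≥k n ⟩
      (mono k ⊛ shift k g) n                    ≈⟨ ⊛-congˡ (mono k) shift-shift n ⟩
      (mono k ⊛ shift (suc k) f) n              ≈⟨ sym (mono-suc-⊛-suc k (shift (suc k) f) n) ⟩
      (mono (suc k) ⊛ shift (suc k) f) (suc n)  ∎
      where open ≈-Reasoning

  pow-cong : ∀ k {f g} → f ≋ g → pow f k ≋ pow g k
  pow-cong zero    f≋g = ≋-refl
  pow-cong (suc k) f≋g = ⊛-cong (pow-cong k f≋g) f≋g

  pow-+ : ∀ f j k → pow f (j ℕ.+ k) ≋ pow f j ⊛ pow f k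
  pow-+ f zero    k = ≋-sym (⊛-identityˡ _)
  pow-+ f (suc j) k = ≋-trans (⊛-congʳ f (pow-+ f j k))
    (solve 3 (λ x y z → (x :* y) :* z := (x :* z) :* y) ≋-refl (pow f j) (pow f k) f)
    where open SeriesSolver

  pow-⊛ : ∀ f g k → pow (f ⊛ g) k ≋ pow f k ⊛ pow g k
  pow-⊛ f g zero    = ≋-sym (⊛-identityˡ _)
  pow-⊛ f g (suc k) = ≋-trans (⊛-congʳ (f ⊛ g) (pow-⊛ f g k))
    (solve 4 (λ x y u v → (x :* y) :* (u :* v) := (x :* u) :* (y :* v)) ≋-refl (pow f k) (pow g k) f g)
    where open SeriesSolver

  pow-pow : ∀ f j k → pow (pow f j) k ≋ pow f (k ℕ.* j)
  pow-pow f j zero    = ≋-refl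
  pow-pow f j (suc k) = ≋-trans (⊛-congʳ (pow f j) (pow-pow f j k))
    (≋-trans (⊛-comm _ _) (≋-sym (pow-+ f j (k ℕ.* j))))

  pow-oneS : ∀ k → pow oneS k ≋ oneS
  pow-oneS zero    = ≋-refl
  pow-oneS (suc k) = ≋-trans (⊛-identityʳ _) (pow-oneS k)

  pow-X : ∀ k → pow X k ≋ mono k
  pow-X zero    zero    = refl
  pow-X zero    (suc n) = refl
  pow-X (suc k) = ≋-trans (⊛-congʳ X (pow-X k)) (≋-trans (⊛-comm _ _) (X⊛mono k))

  Ord≥-pow : ∀ {c f} → Ord≥ c f → ∀ k → Ord≥ (k ℕ.* c) (pow f k)
  Ord≥-pow f≥c zero    n ()
  Ord≥-pow {c} {f} f≥c (suc k) =
    ≡.subst (λ j → Ord≥ j (pow f (suc k))) (ℕP.+-comm (k ℕ.* c) c) (Ord≥-⊛ (Ord≥-pow f≥c k) f≥c)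

  Ord≥-pow₁ : ∀ {f} → Ord≥ 1 f → ∀ k → Ord≥ k (pow f k)
  Ord≥-pow₁ {f} f≥1 k = ≡.subst (λ j → Ord≥ j (pow f k)) (ℕP.*-identityʳ k) (Ord≥-pow f≥1 k)

  prodS-cong : ∀ m {F G : ℕ → FPS} → (∀ i → 1 ≤ i → i ≤ m → F i ≋ G i) → prodS m F ≋ prodS m G
  prodS-cong zero    F≋G = ≋-refl
  prodS-cong (suc m) F≋G =
    ⊛-cong (prodS-cong m (λ i 1≤i i≤m → F≋G i 1≤i (ℕP.m≤n⇒m≤1+n i≤m))) (F≋G (suc m) (s≤s z≤n) ℕP.≤-refl)

  prodS-⊛ : ∀ m (F G : ℕ → FPS) → prodS m (λ i → F i ⊛ G i) ≋ prodS m F ⊛ prodS m G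
  prodS-⊛ zero    F G = ≋-sym (⊛-identityˡ _)
  prodS-⊛ (suc m) F G = ≋-trans (⊛-congʳ (F (suc m) ⊛ G (suc m)) (prodS-⊛ m F G))
    (solve 4 (λ x y u v → (x :* y) :* (u :* v) := (x :* u) :* (y :* v)) ≋-refl (prodS m F) (prodS m G) (F (suc m)) (G (suc m)))
    where open SeriesSolver

  prodS-const : ∀ m f → prodS m (λ _ → f) ≋ pow f m
  prodS-const zero    f = ≋-refl
  prodS-const (suc m) f = ⊛-congʳ f (prodS-const m f)

  prodS-oneS-tail : ∀ p q (F : ℕ → FPS) → p ≤ q → (∀ i → p < i → i ≤ q → F i ≋ oneS) → prodS q F ≋ prodS p F
  prodS-oneS-tail p q F p≤q F≋1 with ℕP.m≤n⇒m<n∨m≡n p≤q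
  ... | inj₂ ≡.refl = ≋-refl
  prodS-oneS-tail p (suc q) F _ F≋1 | inj₁ (s≤s p≤q) = ≋-trans
    (⊛-cong (prodS-oneS-tail p q F p≤q (λ i p<i i≤q → F≋1 i p<i (ℕP.m≤n⇒m≤1+n i≤q)))
            (F≋1 (suc q) (s≤s p≤q) ℕP.≤-refl))
    (⊛-identityʳ _)

  Ord≥-prodS : ∀ m (F : ℕ → FPS) → (∀ i → 1 ≤ i → i ≤ m → Ord≥ 1 (F i)) → Ord≥ m (prodS m F)
  Ord≥-prodS zero    F F≥1 n ()
  Ord≥-prodS (suc m) F F≥1 = ≡.subst (λ j → Ord≥ j (prodS (suc m) F)) (ℕP.+-comm m 1)
    (Ord≥-⊛ (Ord≥-prodS m F (λ i 1≤i i≤m → F≥1 i 1≤i (ℕP.m≤n⇒m≤1+n i≤m)))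
            (F≥1 (suc m) (s≤s z≤n) ℕP.≤-refl))

  prodK-cong : ∀ m {F G : ℕ → Carrier} → (∀ i → F i ≈ G i) → prodK m F ≈ prodK m G
  prodK-cong zero    F≈G = refl
  prodK-cong (suc m) F≈G = *-cong (prodK-cong m F≈G) (F≈G (suc m))

  prodS-coeff-0 : ∀ m (F : ℕ → FPS) → prodS m F 0 ≈ prodK m (λ i → F i 0)
  prodS-coeff-0 zero    F = refl
  prodS-coeff-0 (suc m) F = *-congʳ (prodS-coeff-0 m F)

  ⊛-coeff-cong : ∀ n f {g g′} → (∀ i → i ≤ n → g i ≈ g′ i) → (f ⊛ g) n ≈ (f ⊛ g′) n
  ⊛-coeff-cong n f g≈g′ = Σ≤-cong-≤ n (λ i i≤n → *-congˡ (g≈g′ (n ∸ i) (ℕP.m∸n≤m n i)))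

  Unit : FPS → Set r
  Unit f = f 0 * inv (f 0) ≈ 1#

  module _ (f : FPS) (unit : Unit f) where
    private
      q : FPS
      q = oneS ⊖ scale (inv (f 0)) f

      geometric : ℕ → FPS
      geometric zero    = oneS
      geometric (suc N) = geometric N ⊕ pow q (suc N)

      geometric-coeff : ∀ N n → geometric N n ≈ Σ≤ N (λ k → pow q k n)
      geometric-coeff zero    n = refl
      geometric-coeff (suc N) n = +-congʳ (geometric-coeff N n)

      q≥1 : Ord≥ 1 q
      q≥1 zero    _         = trans (+-congˡ (-‿cong (trans (*-comm _ _) unit))) (-‿inverseʳ _)
      q≥1 (suc n) (s≤s ())

      telescope : ∀ N → (oneS ⊖ q) ⊛ geometric N ≋ oneS ⊖ pow q (suc N)
      telescope zero    = ≋-trans (⊛-identityʳ _) (⊖-cong ≋-refl (≋-sym (⊛-identityˡ q)))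
      telescope (suc N) = ≋-trans (⊛-distribˡ (oneS ⊖ q) (geometric N) (pow q (suc N)))
        (≋-trans (⊕-cong (telescope N) ≋-refl)
        (solve 2 (λ p x → (con (+ 1) :- p) :+ (con (+ 1) :- x) :* p := con (+ 1) :- p :* x) ≋-refl (pow q (suc N)) q))
        where
        open SeriesSolver
        open import Data.Integer using (+_)

      T : FPS
      T n = Σ≤ n (λ k → pow q k n)

      f⊛invS≋[1-q]⊛T : f ⊛ invS f ≋ (oneS ⊖ q) ⊛ T
      f⊛invS≋[1-q]⊛T = begin
        f ⊛ invS f
          ≈⟨ ⊛-congˡ f (≋-sym (const⊛ (inv (f 0)) T)) ⟩
        f ⊛ (const (inv (f 0)) ⊛ T)
          ≈⟨ solve 3 (λ x c t → x :* (c :* t) := (con (+ 1) :- (con (+ 1) :- c :* x)) :* t)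
             ≋-refl f (const (inv (f 0))) T ⟩
        (oneS ⊖ (oneS ⊖ const (inv (f 0)) ⊛ f)) ⊛ T
          ≈⟨ ⊛-congʳ T (⊖-cong ≋-refl (⊖-cong ≋-refl (const⊛ (inv (f 0)) f))) ⟩
        (oneS ⊖ q) ⊛ T                                   ∎
        where
        open ≋-Reasoning
        open SeriesSolver
        open import Data.Integer using (+_)

    invS-inverseʳ : f ⊛ invS f ≋ oneS
    invS-inverseʳ n = begin
      (f ⊛ invS f) n
        ≈⟨ f⊛invS≋[1-q]⊛T n ⟩
      ((oneS ⊖ q) ⊛ T) n
        ≈⟨ ⊛-coeff-cong n (oneS ⊖ q) (λ j j≤n → trans
           (sym (Σ≤-extend j n _ j≤n (λ k j<k _ → Ord≥-pow₁ q≥1 k j j<k))) (sym (geometric-coeff n j))) ⟩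
      ((oneS ⊖ q) ⊛ geometric n) n
        ≈⟨ telescope n n ⟩
      oneS n - pow q (suc n) n
        ≈⟨ +-congˡ (trans (-‿cong (Ord≥-pow₁ q≥1 (suc n) n ℕP.≤-refl)) -0#≈0#) ⟩
      oneS n + 0#
        ≈⟨ +-identityʳ _ ⟩
      oneS n                         ∎
      where open ≈-Reasoning

  invS-unique : ∀ f → Unit f → ∀ g → f ⊛ g ≋ oneS → g ≋ invS f
  invS-unique f unit g f⊛g≋1 = begin
    g                    ≈⟨ ≋-sym (⊛-identityʳ g) ⟩
    g ⊛ oneS             ≈⟨ ⊛-congˡ g (≋-sym (invS-inverseʳ f unit)) ⟩
    g ⊛ (f ⊛ invS f)     ≈⟨ ≋-sym (⊛-assoc g f (invS f)) ⟩
    (g ⊛ f) ⊛ invS f     ≈⟨ ⊛-congʳ (invS f) (≋-trans (⊛-comm g f) f⊛g≋1) ⟩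
    oneS ⊛ invS f        ≈⟨ ⊛-identityˡ _ ⟩
    invS f               ∎
    where open ≋-Reasoning

  ⊛-cancelʳ-Unit : ∀ f → Unit f → ∀ g g′ → g ⊛ f ≋ g′ ⊛ f → g ≋ g′
  ⊛-cancelʳ-Unit f unit g g′ eq = ≋-trans (≋-sym (cancel g)) (≋-trans (⊛-congʳ (invS f) eq) (cancel g′))
    where
    cancel : ∀ y → (y ⊛ f) ⊛ invS f ≋ y
    cancel y = ≋-trans (⊛-assoc y f (invS f)) (≋-trans (⊛-congˡ y (invS-inverseʳ f unit)) (⊛-identityʳ y))

  comp-congʳ : ∀ F {h h′} → h ≋ h′ → comp F h ≋ comp F h′
  comp-congʳ F h≋h′ n = Σ≤-cong n (λ k → *-congˡ (pow-cong k h≋h′ n))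

  comp-coeff-0 : ∀ F h → comp F h 0 ≈ F 0
  comp-coeff-0 F h = *-identityʳ _

  comp-X-right : ∀ F → comp F X ≋ F
  comp-X-right F n = begin
    comp F X n
      ≈⟨ Σ≤-single n n _ ℕP.≤-refl (λ k _ k≢n →
           trans (*-congˡ (trans (pow-X k n) (mono-offDiagonal k n (k≢n ∘ ≡.sym)))) (zeroʳ _)) ⟩
    F n * pow X n n
      ≈⟨ *-congˡ (trans (pow-X n n) (mono-diagonal n)) ⟩
    F n * 1#
      ≈⟨ *-identityʳ _ ⟩
    F n               ∎
    where open ≈-Reasoning

  module Composition (h : FPS) (h≥1 : Ord≥ 1 h) where

    comp-coeff-extend : ∀ F n N → n ≤ N → comp F h n ≈ Σ≤ N (λ k → F k * pow h k n)
    comp-coeff-extend F n N n≤N =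
      sym (Σ≤-extend n N _ n≤N (λ k n<k _ → trans (*-congˡ (Ord≥-pow₁ h≥1 k n n<k)) (zeroʳ _)))

    comp-⊛ : ∀ F G → comp (F ⊛ G) h ≋ comp F h ⊛ comp G h
    comp-⊛ F G n = sym (begin
      Σ≤ n (λ a → comp F h a * comp G h (n ∸ a))
        ≈⟨ Σ≤-cong-≤ n (λ a a≤n →
             *-cong (comp-coeff-extend F a n a≤n) (comp-coeff-extend G (n ∸ a) n (ℕP.m∸n≤m n a))) ⟩
      Σ≤ n (λ a → Σ≤ n (λ i → F i * P i a) * Σ≤ n (λ j → G j * P j (n ∸ a)))
        ≈⟨ Σ≤-cong n (λ a → Σ≤-product n n _ _) ⟩
      Σ≤ n (λ a → Σ≤ n (λ i → Σ≤ n (λ j → (F i * P i a) * (G j * P j (n ∸ a)))))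
        ≈⟨ trans (Σ≤-swap n n _) (Σ≤-cong n (λ i → Σ≤-swap n n _)) ⟩
      Σ≤ n (λ i → Σ≤ n (λ j → Σ≤ n (λ a → (F i * P i a) * (G j * P j (n ∸ a)))))
        ≈⟨ Σ≤-cong n (λ i → Σ≤-cong n (λ j → Σ≤-cong n (λ a →
           solve 4 (λ x y u v → (x :* u) :* (y :* v) := (x :* y) :* (u :* v)) refl (F i) (G j) (P i a) (P j (n ∸ a))))) ⟩
      Σ≤ n (λ i → Σ≤ n (λ j → Σ≤ n (λ a → (F i * G j) * (P i a * P j (n ∸ a)))))
        ≈⟨ Σ≤-cong n (λ i → Σ≤-cong n (λ j → trans (sym (*-distribˡ-Σ≤ n _ _)) (*-congˡ (sym (pow-+ h i j n))))) ⟩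
      Σ≤ n (λ i → Σ≤ n (λ j → (F i * G j) * P (i ℕ.+ j) n))
        ≈⟨ Σ≤-cong-≤ n (λ i i≤n → Σ≤-extend (n ∸ i) n _ (ℕP.m∸n≤m n i) (λ j n∸i<j _ →
           trans (*-congˡ (Ord≥-pow₁ h≥1 (i ℕ.+ j) n
             (≡.subst (_< i ℕ.+ j) (ℕP.m+[n∸m]≡n i≤n) (ℕP.+-monoʳ-< i n∸i<j)))) (zeroʳ _))) ⟩
      Σ≤ n (λ i → Σ≤ (n ∸ i) (λ j → (F i * G j) * P (i ℕ.+ j) n))
        ≈⟨ Σ≤-cong n (λ i → Σ≤-cong (n ∸ i) (λ j →
             *-congʳ (*-congˡ (reflexive (≡.cong G (≡.sym (ℕP.m+n∸m≡n i j))))))) ⟩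
      Σ≤ n (λ i → Σ≤ (n ∸ i) (λ j → (F i * G ((i ℕ.+ j) ∸ i)) * P (i ℕ.+ j) n))
        ≈⟨ sym (Σ≤-triangle n (λ i k → (F i * G (k ∸ i)) * P k n)) ⟩
      Σ≤ n (λ k → Σ≤ k (λ i → (F i * G (k ∸ i)) * P k n))
        ≈⟨ Σ≤-cong n (λ k → sym (*-distribʳ-Σ≤ k _ _)) ⟩
      comp (F ⊛ G) h n ∎)
      where
      open ≈-Reasoning
      open IntegerRingSolver R
      P : ℕ → FPS
      P = pow h

    comp-congˡ : ∀ {F G} → F ≋ G → comp F h ≋ comp G h
    comp-congˡ F≋G n = Σ≤-cong n (λ k → *-congʳ (F≋G k))

    comp-⊕ : ∀ F G → comp (F ⊕ G) h ≋ comp F h ⊕ comp G h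
    comp-⊕ F G n = trans (Σ≤-cong n (λ k → distribʳ _ _ _)) (Σ≤-distrib-+ n _ _)

    comp-⊖ : ∀ F G → comp (F ⊖ G) h ≋ comp F h ⊖ comp G h
    comp-⊖ F G n = begin
      Σ≤ n (λ k → (F k - G k) * pow h k n)
        ≈⟨ Σ≤-cong n (λ k → trans (distribʳ _ _ _) (+-congˡ (sym (-‿distribˡ-* _ _)))) ⟩
      Σ≤ n (λ k → F k * pow h k n + - (G k * pow h k n))
        ≈⟨ Σ≤-distrib-+ n _ _ ⟩
      comp F h n + Σ≤ n (λ k → - (G k * pow h k n))
        ≈⟨ +-congˡ (sym (-‿distrib-Σ≤ n _)) ⟩
      comp F h n - comp G h n                                     ∎
      where
      open ≈-Reasoning
      open import Algebra.Properties.Ring ring using (-‿distribˡ-*)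

    comp-scale : ∀ c F → comp (scale c F) h ≋ scale c (comp F h)
    comp-scale c F n = trans (Σ≤-cong n (λ k → *-assoc _ _ _)) (sym (*-distribˡ-Σ≤ n c _))

    comp-const : ∀ c → comp (const c) h ≋ const c
    comp-const c n = trans (Σ≤-head n _ (λ i → zeroˡ _)) (c*oneS n)
      where
      c*oneS : ∀ n → c * oneS n ≈ const c n
      c*oneS zero    = *-identityʳ _
      c*oneS (suc n) = zeroʳ _

    comp-oneS : comp oneS h ≋ oneS
    comp-oneS = ≋-trans (comp-congˡ (≋-sym const-1#)) (≋-trans (comp-const 1#) const-1#)

    comp-X : comp X h ≋ h
    comp-X zero    = trans (zeroˡ _) (sym (h≥1 0 (s≤s z≤n)))
    comp-X (suc n) = trans (Σ≤-single (suc n) 1 _ (s≤s z≤n) X-off) (trans (*-identityˡ _) (⊛-identityˡ h (suc n)))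
      where
      X-off : ∀ i → i ≤ suc n → i ≢ 1 → X i * pow h i (suc n) ≈ 0#
      X-off zero          _ _   = zeroˡ _
      X-off (suc zero)    _ i≢1 = contradiction ≡.refl i≢1
      X-off (suc (suc i)) _ _   = zeroˡ _

    comp-pow : ∀ F k → comp (pow F k) h ≋ pow (comp F h) k
    comp-pow F zero    = comp-oneS
    comp-pow F (suc k) = ≋-trans (comp-⊛ (pow F k) F) (⊛-congʳ (comp F h) (comp-pow F k))

    comp-mono : ∀ k → comp (mono k) h ≋ pow h k
    comp-mono k = ≋-trans (comp-congˡ (≋-sym (pow-X k))) (≋-trans (comp-pow X k) (pow-cong k comp-X))

    comp-prodS : ∀ m (F : ℕ → FPS) → comp (prodS m F) h ≋ prodS m (λ i → comp (F i) h)
    comp-prodS zero    F = comp-oneS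
    comp-prodS (suc m) F = ≋-trans (comp-⊛ (prodS m F) (F (suc m))) (⊛-congʳ (comp (F (suc m)) h) (comp-prodS m F))

    comp-Ord≥ : ∀ k F → Ord≥ k F → comp F h ≋ pow h k ⊛ comp (shift k F) h
    comp-Ord≥ k F F≥k = ≋-trans (comp-congˡ (Ord≥⇒≋mono⊛shift k F F≥k))
      (≋-trans (comp-⊛ (mono k) (shift k F)) (⊛-congʳ (comp (shift k F) h) (comp-mono k)))

    comp-invS : ∀ F → Unit F → Unit (comp F h) → comp (invS F) h ≋ invS (comp F h)
    comp-invS F unit unit∘h = invS-unique (comp F h) unit∘h (comp (invS F) h)
      (≋-trans (≋-sym (comp-⊛ F (invS F))) (≋-trans (comp-congˡ (invS-inverseʳ F unit)) comp-oneS))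

    ⊛-comp : ∀ C Z n → (C ⊛ comp Z h) n ≈ Σ≤ n (λ i → Z i * (C ⊛ pow h i) n)
    ⊛-comp C Z n = begin
      Σ≤ n (λ a → C a * comp Z h (n ∸ a))
        ≈⟨ Σ≤-cong-≤ n (λ a a≤n → *-congˡ (comp-coeff-extend Z (n ∸ a) n (ℕP.m∸n≤m n a))) ⟩
      Σ≤ n (λ a → C a * Σ≤ n (λ i → Z i * pow h i (n ∸ a)))
        ≈⟨ Σ≤-cong n (λ a → trans (*-distribˡ-Σ≤ n (C a) _) (Σ≤-cong n (λ i →
           solve 3 (λ x y z → x :* (y :* z) := y :* (x :* z)) refl (C a) (Z i) (pow h i (n ∸ a))))) ⟩
      Σ≤ n (λ a → Σ≤ n (λ i → Z i * (C a * pow h i (n ∸ a))))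
        ≈⟨ Σ≤-swap n n _ ⟩
      Σ≤ n (λ i → Σ≤ n (λ a → Z i * (C a * pow h i (n ∸ a))))
        ≈⟨ Σ≤-cong n (λ i → sym (*-distribˡ-Σ≤ n (Z i) _)) ⟩
      Σ≤ n (λ i → Z i * (C ⊛ pow h i) n)                        ∎
      where
      open ≈-Reasoning
      open IntegerRingSolver R

  comp-assoc : ∀ F g h → Ord≥ 1 g → Ord≥ 1 h → comp (comp F g) h ≋ comp F (comp g h)
  comp-assoc F g h g≥1 h≥1 n = begin
    Σ≤ n (λ m → comp F g m * pow h m n)
      ≈⟨ Σ≤-cong-≤ n (λ m m≤n → *-congʳ (comp-coeff-extend g g≥1 F m n m≤n)) ⟩
    Σ≤ n (λ m → Σ≤ n (λ k → F k * pow g k m) * pow h m n)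
      ≈⟨ Σ≤-cong n (λ m → trans (*-distribʳ-Σ≤ n _ _) (Σ≤-cong n (λ k → *-assoc _ _ _))) ⟩
    Σ≤ n (λ m → Σ≤ n (λ k → F k * (pow g k m * pow h m n))) ≈⟨ Σ≤-swap n n _ ⟩
    Σ≤ n (λ k → Σ≤ n (λ m → F k * (pow g k m * pow h m n))) ≈⟨ Σ≤-cong n (λ k → sym (*-distribˡ-Σ≤ n _ _)) ⟩
    Σ≤ n (λ k → F k * comp (pow g k) h n)
      ≈⟨ Σ≤-cong n (λ k → *-congˡ (comp-pow h h≥1 g k n)) ⟩
    comp F (comp g h) n                                     ∎
    where
    open ≈-Reasoning
    open Composition

  AgreeUpTo : ℕ → FPS → FPS → Set r
  AgreeUpTo N f g = ∀ i → i ≤ N → f i ≈ g i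

  AgreeUpTo-⊛ : ∀ N {f f′ g g′} → AgreeUpTo N f f′ → AgreeUpTo N g g′ → AgreeUpTo N (f ⊛ g) (f′ ⊛ g′)
  AgreeUpTo-⊛ N f≈f′ g≈g′ n n≤N = Σ≤-cong-≤ n (λ i i≤n →
    *-cong (f≈f′ i (ℕP.≤-trans i≤n n≤N)) (g≈g′ (n ∸ i) (ℕP.≤-trans (ℕP.m∸n≤m n i) n≤N)))

  AgreeUpTo-pow : ∀ N {f g} → AgreeUpTo N f g → ∀ k → AgreeUpTo N (pow f k) (pow g k)
  AgreeUpTo-pow N f≈g zero    i _ = refl
  AgreeUpTo-pow N f≈g (suc k)     = AgreeUpTo-⊛ N (AgreeUpTo-pow N f≈g k) f≈g

  pow-coeff-perturb : ∀ N v w → AgreeUpTo N v w → ∀ k →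
    pow v (suc k) (suc N) ≈ pow w (suc k) (suc N) + natK R (suc k) * (pow v k 0 * (v (suc N) - w (suc N)))
  pow-coeff-perturb N v w v≈w zero = begin
    (oneS ⊛ v) (suc N)
      ≈⟨ ⊛-identityˡ v (suc N) ⟩
    v (suc N)
      ≈⟨ solve 2 (λ x y → x := y :+ (con (+ 1) :+ con (+ 0)) :* (con (+ 1) :* (x :- y))) refl (v (suc N)) (w (suc N)) ⟩
    w (suc N) + (1# + 0#) * (1# * δ)
      ≈⟨ +-congʳ (sym (⊛-identityˡ w (suc N))) ⟩
    (oneS ⊛ w) (suc N) + natK R 1 * (pow v 0 0 * δ)  ∎
    where
    open ≈-Reasoning
    open IntegerRingSolver R
    open import Data.Integer using (+_)
    δ : Carrier
    δ = v (suc N) - w (suc N)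
  pow-coeff-perturb N v w v≈w (suc k) = begin
    Σ≤ N G + G n
      ≈⟨ +-congʳ (Σ≤-agree-off-0 N G G′ G≈G′) ⟩
    (Σ≤ N G′ + (A 0 * v n - B 0 * w n)) + A n * v (n ∸ n)
      ≈⟨ +-cong (+-congˡ (+-congˡ (-‿cong (*-congʳ (sym (A≈B 0 z≤n))))))
                (*-cong (pow-coeff-perturb N v w v≈w k) (reflexive (≡.cong v (ℕP.n∸n≡0 n)))) ⟩
    (Σ≤ N G′ + ((p * v 0) * v n - (p * v 0) * w n)) + (B n + K * (p * δ)) * v 0
      ≈⟨ solve 7 (λ S P v₀ vₙ wₙ Bₙ K′ →
         (S :+ ((P :* v₀) :* vₙ :- (P :* v₀) :* wₙ)) :+ (Bₙ :+ K′ :* (P :* (vₙ :- wₙ))) :* v₀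
         := (S :+ Bₙ :* v₀) :+ (con (+ 1) :+ K′) :* ((P :* v₀) :* (vₙ :- wₙ)))
         refl (Σ≤ N G′) p (v 0) (v n) (w n) (B n) K ⟩
    (Σ≤ N G′ + B n * v 0) + (1# + K) * ((p * v 0) * δ)
      ≈⟨ +-congʳ (+-congˡ (*-congˡ (trans (v≈w 0 z≤n) (reflexive (≡.cong w (≡.sym (ℕP.n∸n≡0 n))))))) ⟩
    (Σ≤ N G′ + B n * w (n ∸ n)) + natK R (suc (suc k)) * (pow v (suc k) 0 * δ)
         ∎
    where
    open ≈-Reasoning
    open IntegerRingSolver R
    open import Data.Integer using (+_)
    n : ℕ
    n = suc N
    δ : Carrier
    δ = v n - w n
    A B : FPS
    A = pow v (suc k)
    B = pow w (suc k)
    G G′ : ℕ → Carrier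
    G i = A i * v (n ∸ i)
    G′ i = B i * w (n ∸ i)
    K : Carrier
    K = natK R (suc k)
    p : Carrier
    p = pow v k 0
    A≈B : AgreeUpTo N A B
    A≈B = AgreeUpTo-pow N v≈w (suc k)
    G≈G′ : ∀ i → 1 ≤ i → i ≤ N → G i ≈ G′ i
    G≈G′ (suc i) _ i<N = *-cong (A≈B (suc i) i<N) (v≈w (N ∸ i) (ℕP.m∸n≤m N i))

module FieldProperties {a r} (R : CommutativeRing a r) (inv : CommutativeRing.Carrier R → CommutativeRing.Carrier R)
                       (isField : IsField R inv) where

  open import Data.Nat as ℕ using (zero; suc; _≤_; z≤n; s≤s)
  import Data.Nat.Properties as ℕP
  open import Relation.Nullary using (¬_)
  open CommutativeRing R
  open IsField isField
  open PowerSeriesRing R inv using (pow; Unit)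
  open Series R inv using (prodK)
  open import Relation.Binary.Reasoning.Setoid setoid

  no-zero-divisors : ∀ {x y} → ¬ (x ≈ 0#) → x * y ≈ 0# → y ≈ 0#
  no-zero-divisors {x} {y} x≉0 xy≈0 = begin
    y                  ≈⟨ sym (*-identityˡ _) ⟩
    1# * y             ≈⟨ *-congʳ (sym (trans (*-comm _ _) (inverse x x≉0))) ⟩
    (inv x * x) * y    ≈⟨ *-assoc _ _ _ ⟩
    inv x * (x * y)    ≈⟨ *-congˡ xy≈0 ⟩
    inv x * 0#         ≈⟨ zeroʳ _ ⟩
    0#                 ∎

  *-≉0 : ∀ {x y} → ¬ (x ≈ 0#) → ¬ (y ≈ 0#) → ¬ (x * y ≈ 0#)
  *-≉0 x≉0 y≉0 xy≈0 = y≉0 (no-zero-divisors x≉0 xy≈0)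

  prodK-≉0 : ∀ m (F : ℕ → Carrier) → (∀ i → 1 ≤ i → i ≤ m → ¬ (F i ≈ 0#)) → ¬ (prodK m F ≈ 0#)
  prodK-≉0 zero    F _     = 1≉0
  prodK-≉0 (suc m) F F≉0 =
    *-≉0 (prodK-≉0 m F (λ i 1≤i i≤m → F≉0 i 1≤i (ℕP.m≤n⇒m≤1+n i≤m))) (F≉0 (suc m) (s≤s z≤n) ℕP.≤-refl)

  pow-coeff-0-≉0 : ∀ f → ¬ (f 0 ≈ 0#) → ∀ k → ¬ (pow f k 0 ≈ 0#)
  pow-coeff-0-≉0 f f₀≉0 zero    = 1≉0
  pow-coeff-0-≉0 f f₀≉0 (suc k) = *-≉0 (pow-coeff-0-≉0 f f₀≉0 k) f₀≉0

  ≉0⇒Unit : ∀ f → ¬ (f 0 ≈ 0#) → Unit f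
  ≉0⇒Unit f = inverse (f 0)

module GradedSeries {a r} (R : CommutativeRing a r) (inv : CommutativeRing.Carrier R → CommutativeRing.Carrier R)
              (ℓ : ℕ) .{{_ : NonZero ℓ}} where

  open import Data.Nat as ℕ using (zero; suc; pred; _∸_; _≤_; z≤n; s≤s)
  import Data.Nat.Properties as ℕP
  open import Data.Nat.DivMod using (_%_; %-distribˡ-+; [m+kn]%n≡m%n; n%n≡0; m*n%n≡0; m<n⇒m%n≡m)
  open import Data.Nat.Divisibility using (n∣m⇒m%n≡0)
  open import Relation.Binary.PropositionalEquality as ≡ using (_≡_; _≢_)
  open import Relation.Nullary using (¬_; Dec; yes; no; contradiction)
  open import Data.Sum using (inj₁; inj₂)
  open import Function using (_∘_)
  open CommutativeRing R
  open FiniteSums R inv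
  open PowerSeriesRing R inv
  open import Algebra.Properties.Ring ring using (-0#≈0#)

  infix 4 _≡ₘ_
  _≡ₘ_ : ℕ → ℕ → Set
  m ≡ₘ n = m % ℓ ≡ n % ℓ

  0%ℓ≡0 : 0 % ℓ ≡ 0
  0%ℓ≡0 = m*n%n≡0 0 ℓ

  +-resp-≡ₘ : ∀ {x y} c → x ≡ₘ y → x ℕ.+ c ≡ₘ y ℕ.+ c
  +-resp-≡ₘ {x} {y} c x≡y = begin
    (x ℕ.+ c) % ℓ              ≡⟨ %-distribˡ-+ x c ℓ ⟩
    (x % ℓ ℕ.+ c % ℓ) % ℓ      ≡⟨ ≡.cong (λ z → (z ℕ.+ c % ℓ) % ℓ) x≡y ⟩
    (y % ℓ ℕ.+ c % ℓ) % ℓ      ≡⟨ %-distribˡ-+ y c ℓ ⟨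
    (y ℕ.+ c) % ℓ              ∎
    where open ≡.≡-Reasoning

  +-cancelʳ-≡ₘ : ∀ x y k → x ℕ.+ k ≡ₘ y ℕ.+ k → x ≡ₘ y
  +-cancelʳ-≡ₘ x y k x+k≡y+k = begin
    x % ℓ                              ≡⟨ add-kℓ x ⟨
    (x ℕ.+ k ℕ.+ pred ℓ ℕ.* k) % ℓ     ≡⟨ +-resp-≡ₘ (pred ℓ ℕ.* k) x+k≡y+k ⟩
    (y ℕ.+ k ℕ.+ pred ℓ ℕ.* k) % ℓ     ≡⟨ add-kℓ y ⟩
    y % ℓ                              ∎
    where
    open ≡.≡-Reasoning
    add-kℓ : ∀ z → (z ℕ.+ k ℕ.+ pred ℓ ℕ.* k) % ℓ ≡ z % ℓ
    add-kℓ z = ≡.trans (≡.cong (_% ℓ) (≡.trans (ℕP.+-assoc z k (pred ℓ ℕ.* k))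
                 (≡.cong (z ℕ.+_) (≡.trans (≡.cong (ℕ._* k) (ℕP.suc-pred ℓ)) (ℕP.*-comm ℓ k)))))
               ([m+kn]%n≡m%n z k ℓ)

  record Homogeneous (s : ℕ) (F : FPS) : Set r where
    constructor homogeneous
    field vanish : ∀ n → ¬ (n ≡ₘ s) → F n ≈ 0#
  open Homogeneous public

  record VanishesOnClass (s : ℕ) (F : FPS) : Set r where
    constructor vanishesOnClass
    field vanish-on : ∀ n → n ≡ₘ s → F n ≈ 0#
  open VanishesOnClass public

  Homogeneous-cong : ∀ {s F G} → F ≋ G → Homogeneous s F → Homogeneous s G
  Homogeneous-cong F≋G F-hom = homogeneous λ n n≢s → trans (sym (F≋G n)) (vanish F-hom n n≢s)

  Homogeneous-resp-≡ₘ : ∀ {s t F} → s ≡ₘ t → Homogeneous s F → Homogeneous t F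
  Homogeneous-resp-≡ₘ s≡t F-hom = homogeneous λ n n≢t → vanish F-hom n (λ n≡s → n≢t (≡.trans n≡s s≡t))

  Homogeneous-⊕ : ∀ {s F G} → Homogeneous s F → Homogeneous s G → Homogeneous s (F ⊕ G)
  Homogeneous-⊕ F-hom G-hom = homogeneous λ n n≢s →
    trans (+-cong (vanish F-hom n n≢s) (vanish G-hom n n≢s)) (+-identityʳ _)

  Homogeneous-⊖ : ∀ {s F G} → Homogeneous s F → Homogeneous s G → Homogeneous s (F ⊖ G)
  Homogeneous-⊖ F-hom G-hom = homogeneous λ n n≢s →
    trans (+-cong (vanish F-hom n n≢s) (trans (-‿cong (vanish G-hom n n≢s)) -0#≈0#)) (+-identityʳ _)

  Homogeneous-scale : ∀ {s F} c → Homogeneous s F → Homogeneous s (scale c F)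
  Homogeneous-scale c F-hom = homogeneous λ n n≢s → trans (*-congˡ (vanish F-hom n n≢s)) (zeroʳ _)

  Homogeneous-const : ∀ c → Homogeneous 0 (const c)
  Homogeneous-const c = homogeneous λ where
    zero    n≢0 → contradiction ≡.refl n≢0
    (suc n) _   → refl

  Homogeneous-oneS : Homogeneous 0 oneS
  Homogeneous-oneS = Homogeneous-cong const-1# (Homogeneous-const 1#)

  Homogeneous-X : Homogeneous 1 X
  Homogeneous-X = homogeneous λ where
    zero          _   → refl
    (suc zero)    n≢1 → contradiction ≡.refl n≢1
    (suc (suc n)) _   → refl

  Homogeneous-⊛ : ∀ {s t F G} → Homogeneous s F → Homogeneous t G → Homogeneous (s ℕ.+ t) (F ⊛ G)
  Homogeneous-⊛ {s} {t} {F} {G} F-hom G-hom = homogeneous λ n n≢s+t → Σ≤-zero n _ (term n n≢s+t)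
    where
    term : ∀ n → ¬ (n ≡ₘ s ℕ.+ t) → ∀ i → i ≤ n → F i * G (n ∸ i) ≈ 0#
    term n n≢s+t i i≤n with i % ℓ ℕ.≟ s % ℓ
    ... | no  i≢s = trans (*-congʳ (vanish F-hom i i≢s)) (zeroˡ _)
    ... | yes i≡s = trans (*-congˡ (vanish G-hom (n ∸ i) n∸i≢t)) (zeroʳ _)
      where
      n∸i≢t : ¬ (n ∸ i ≡ₘ t)
      n∸i≢t n∸i≡t = n≢s+t (begin
        n % ℓ                              ≡⟨ ≡.cong (_% ℓ) (ℕP.m+[n∸m]≡n i≤n) ⟨
        (i ℕ.+ (n ∸ i)) % ℓ                ≡⟨ %-distribˡ-+ i (n ∸ i) ℓ ⟩
        (i % ℓ ℕ.+ (n ∸ i) % ℓ) % ℓ        ≡⟨ ≡.cong₂ (λ x y → (x ℕ.+ y) % ℓ) i≡s n∸i≡t ⟩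
        (s % ℓ ℕ.+ t % ℓ) % ℓ              ≡⟨ %-distribˡ-+ s t ℓ ⟨
        (s ℕ.+ t) % ℓ                      ∎)
        where open ≡.≡-Reasoning

  Homogeneous-pow : ∀ {s F} → Homogeneous s F → ∀ k → Homogeneous (k ℕ.* s) (pow F k)
  Homogeneous-pow F-hom zero    = Homogeneous-oneS
  Homogeneous-pow {s} F-hom (suc k) =
    Homogeneous-resp-≡ₘ (≡.cong (_% ℓ) (ℕP.+-comm (k ℕ.* s) s)) (Homogeneous-⊛ (Homogeneous-pow F-hom k) F-hom)

  Homogeneous₀-pow : ∀ {F} → Homogeneous 0 F → ∀ k → Homogeneous 0 (pow F k)
  Homogeneous₀-pow F-hom k = Homogeneous-resp-≡ₘ (≡.cong (_% ℓ) (ℕP.*-zeroʳ k)) (Homogeneous-pow F-hom k)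

  Homogeneous₀-prodS : ∀ m (F : ℕ → FPS) → (∀ i → 1 ≤ i → i ≤ m → Homogeneous 0 (F i)) → Homogeneous 0 (prodS m F)
  Homogeneous₀-prodS zero    F F-hom = Homogeneous-oneS
  Homogeneous₀-prodS (suc m) F F-hom = Homogeneous-⊛
    (Homogeneous₀-prodS m F (λ i 1≤i i≤m → F-hom i 1≤i (ℕP.m≤n⇒m≤1+n i≤m))) (F-hom (suc m) (s≤s z≤n) ℕP.≤-refl)

  Homogeneous-shift : ∀ {t} k {F} → Homogeneous (t ℕ.+ k) F → Homogeneous t (shift k F)
  Homogeneous-shift {t} k F-hom = homogeneous λ n n≢t →
    vanish F-hom (n ℕ.+ k) (λ n+k≡t+k → n≢t (+-cancelʳ-≡ₘ n t k n+k≡t+k))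

  Homogeneous₀-shiftℓ : ∀ {F} → Homogeneous 0 F → Homogeneous 0 (shift ℓ F)
  Homogeneous₀-shiftℓ F-hom = Homogeneous-shift ℓ (Homogeneous-resp-≡ₘ (≡.trans 0%ℓ≡0 (≡.sym (n%n≡0 ℓ))) F-hom)

  Homogeneous₀-invS : ∀ {F} → Homogeneous 0 F → Homogeneous 0 (invS F)
  Homogeneous₀-invS {F} F-hom = homogeneous λ n n≢0 →
    trans (*-congˡ (Σ≤-zero n _ (λ k _ → vanish (Homogeneous₀-pow q-hom k) n n≢0))) (zeroʳ _)
    where
    q-hom : Homogeneous 0 (oneS ⊖ scale (inv (F 0)) F)
    q-hom = Homogeneous-⊖ Homogeneous-oneS (Homogeneous-scale _ F-hom)

  pow-Homogeneous₁ : ∀ {h} → Homogeneous 1 h → ∀ k n → ¬ (n ≡ₘ k) → pow h k n ≈ 0#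
  pow-Homogeneous₁ {h} h-hom k n n≢k =
    vanish (Homogeneous-pow h-hom k) n (λ n≡k*1 → n≢k (≡.trans n≡k*1 (≡.cong (_% ℓ) (ℕP.*-identityʳ k))))

  Homogeneous-comp : ∀ {s F h} → Homogeneous s F → Homogeneous 1 h → Homogeneous s (comp F h)
  Homogeneous-comp {s} {F} {h} F-hom h-hom = homogeneous λ n n≢s → Σ≤-zero n _ (term n n≢s)
    where
    term : ∀ n → ¬ (n ≡ₘ s) → ∀ k → k ≤ n → F k * pow h k n ≈ 0#
    term n n≢s k _ with k % ℓ ℕ.≟ s % ℓ
    ... | no  k≢s = trans (*-congʳ (vanish F-hom k k≢s)) (zeroˡ _)
    ... | yes k≡s = trans (*-congˡ (pow-Homogeneous₁ h-hom k n (λ n≡k → n≢s (≡.trans n≡k k≡s)))) (zeroʳ _)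

  VanishesOnClass-comp : ∀ {s F h} → VanishesOnClass s F → Homogeneous 1 h → VanishesOnClass s (comp F h)
  VanishesOnClass-comp {s} {F} {h} F-van h-hom = vanishesOnClass λ n n≡s → Σ≤-zero n _ (term n n≡s)
    where
    term : ∀ n → n ≡ₘ s → ∀ k → k ≤ n → F k * pow h k n ≈ 0#
    term n n≡s k _ with k % ℓ ℕ.≟ s % ℓ
    ... | yes k≡s = trans (*-congʳ (vanish-on F-van k k≡s)) (zeroˡ _)
    ... | no  k≢s = trans (*-congˡ (pow-Homogeneous₁ h-hom k n (λ n≡k → k≢s (≡.trans (≡.sym n≡k) n≡s)))) (zeroʳ _)

  InPowℓ⇒Homogeneous₀ : ∀ {F} → InPowℓ ℓ F → Homogeneous 0 F
  InPowℓ⇒Homogeneous₀ F∈K[[tˡ]] = homogeneous λ n n≢0 →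
    F∈K[[tˡ]] n (λ ℓ∣n → n≢0 (≡.trans (n∣m⇒m%n≡0 n ℓ ℓ∣n) (≡.sym 0%ℓ≡0)))

  Homogeneous₀⇒Ord≥ℓ : ∀ {F} → Homogeneous 0 F → F 0 ≈ 0# → Ord≥ ℓ F
  Homogeneous₀⇒Ord≥ℓ F-hom F₀≈0 zero    _     = F₀≈0
  Homogeneous₀⇒Ord≥ℓ F-hom F₀≈0 (suc n) 1+n<ℓ = vanish F-hom (suc n) λ 1+n≡0 →
    ℕP.1+n≢0 (≡.trans (≡.sym (m<n⇒m%n≡m 1+n<ℓ)) (≡.trans 1+n≡0 0%ℓ≡0))

  component : ℕ → FPS → FPS
  component s F n with n % ℓ ℕ.≟ s % ℓ
  ... | yes _ = F n
  ... | no  _ = 0#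

  Homogeneous-component : ∀ s F → Homogeneous s (component s F)
  Homogeneous-component s F = homogeneous λ n n≢s → off n n≢s
    where
    off : ∀ n → ¬ (n ≡ₘ s) → component s F n ≈ 0#
    off n n≢s with n % ℓ ℕ.≟ s % ℓ
    ... | yes n≡s = contradiction n≡s n≢s
    ... | no  _   = refl

  component-≡ₘ : ∀ s F n → n ≡ₘ s → component s F n ≈ F n
  component-≡ₘ s F n n≡s with n % ℓ ℕ.≟ s % ℓ
  ... | yes _   = refl
  ... | no  n≢s = contradiction n≡s n≢s

  VanishesOnClass-⊖component : ∀ s F → VanishesOnClass s (F ⊖ component s F)
  VanishesOnClass-⊖component s F = vanishesOnClass λ n n≡s →
    trans (+-congˡ (-‿cong (component-≡ₘ s F n n≡s))) (-‿inverseʳ _)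

  -- By induction on N, v agrees with its degree-0 component w up to degree N: when N + 1 ≢ 0,
  -- both [t^{N+1}] vᵏ⁺¹ and [t^{N+1}] wᵏ⁺¹ vanish, leaving (k + 1) v₀ᵏ (v_{N+1} - w_{N+1}) = 0.
  Homogeneous₀-root : IsField R inv → ∀ k v → ¬ (natK R (suc k) ≈ 0#) → ¬ (v 0 ≈ 0#) →
                      Homogeneous 0 (pow v (suc k)) → Homogeneous 0 v
  Homogeneous₀-root isField k v k+1≉0 v₀≉0 vᵏ⁺¹-hom =
    Homogeneous-cong (λ n → sym (v≈w n n ℕP.≤-refl)) (Homogeneous-component 0 v)
    where
    open FieldProperties R inv isField
    open import Algebra.Properties.Group +-group using (x∙y⁻¹≈ε⇒x≈y)
    w : FPS
    w = component 0 v

    next : ∀ N → AgreeUpTo N v w → v (suc N) ≈ w (suc N)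
    next N v≈w = by-cases (suc N % ℓ ℕ.≟ 0 % ℓ)
      where
      by-cases : Dec (suc N ≡ₘ 0) → v (suc N) ≈ w (suc N)
      by-cases (yes 1+N≡0) = sym (component-≡ₘ 0 v (suc N) 1+N≡0)
      by-cases (no  1+N≢0) =
        x∙y⁻¹≈ε⇒x≈y _ _ (no-zero-divisors (pow-coeff-0-≉0 v v₀≉0 k) (no-zero-divisors k+1≉0 first-order≈0))
        where
        open ≈-Reasoning
        first-order≈0 : natK R (suc k) * (pow v k 0 * (v (suc N) - w (suc N))) ≈ 0#
        first-order≈0 = begin
          natK R (suc k) * (pow v k 0 * (v (suc N) - w (suc N)))
            ≈⟨ sym (+-identityˡ _) ⟩
          0# + natK R (suc k) * (pow v k 0 * (v (suc N) - w (suc N)))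
            ≈⟨ +-congʳ (sym (vanish (Homogeneous₀-pow (Homogeneous-component 0 v) (suc k)) (suc N) 1+N≢0)) ⟩
          pow w (suc k) (suc N) + natK R (suc k) * (pow v k 0 * (v (suc N) - w (suc N)))
            ≈⟨ sym (pow-coeff-perturb N v w v≈w k) ⟩
          pow v (suc k) (suc N)
            ≈⟨ vanish vᵏ⁺¹-hom (suc N) 1+N≢0 ⟩
          0# ∎

    v≈w : ∀ N → AgreeUpTo N v w
    v≈w zero    zero    _   = sym (component-≡ₘ 0 v 0 ≡.refl)
    v≈w (suc N) i       i≤1+N with ℕP.m≤n⇒m<n∨m≡n i≤1+N
    ... | inj₁ (s≤s i≤N) = v≈w N i i≤N
    ... | inj₂ ≡.refl    = next N (v≈w N)

  -- E = h̄ - component 1 h̄ vanishes on the class of 1, hence so does E(h) = t - (component 1 h̄)(h);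
  -- but E(h) is also homogeneous of degree 1, so E(h) = 0 and E = E(h)(h̄) = 0.
  Homogeneous-compInverse : ∀ {h h̄} → Homogeneous 1 h → Ord≥ 1 h → Ord≥ 1 h̄ →
                            comp h h̄ ≋ X → comp h̄ h ≋ X → Homogeneous 1 h̄
  Homogeneous-compInverse {h} {h̄} h-hom h≥1 h̄≥1 h∘h̄≋X h̄∘h≋X =
    Homogeneous-cong (λ n → sym (x∙y⁻¹≈ε⇒x≈y _ _ (E≋0 n))) (Homogeneous-component 1 h̄)
    where
    open Composition h h≥1
    open import Algebra.Properties.Group +-group using (x∙y⁻¹≈ε⇒x≈y)
    E : FPS
    E = h̄ ⊖ component 1 h̄

    E∘h-hom : Homogeneous 1 (comp E h)
    E∘h-hom = Homogeneous-cong (≋-sym (≋-trans (comp-⊖ h̄ _) (⊖-cong h̄∘h≋X ≋-refl)))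
      (Homogeneous-⊖ Homogeneous-X (Homogeneous-comp (Homogeneous-component 1 h̄) h-hom))

    E∘h≋0 : comp E h ≋ zeroS
    E∘h≋0 n with n % ℓ ℕ.≟ 1 % ℓ
    ... | yes n≡1 = vanish-on (VanishesOnClass-comp (VanishesOnClass-⊖component 1 h̄) h-hom) n n≡1
    ... | no  n≢1 = vanish E∘h-hom n n≢1

    E≋0 : E ≋ zeroS
    E≋0 = begin
      E                       ≈⟨ ≋-sym (comp-X-right E) ⟩
      comp E X                ≈⟨ comp-congʳ E (≋-sym h∘h̄≋X) ⟩
      comp E (comp h h̄)       ≈⟨ ≋-sym (comp-assoc E h h̄ h≥1 h̄≥1) ⟩
      comp (comp E h) h̄       ≈⟨ Composition.comp-congˡ h̄ h̄≥1 E∘h≋0 ⟩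
      comp zeroS h̄            ≈⟨ (λ n → Σ≤-zero n _ (λ k _ → zeroˡ _)) ⟩
      zeroS                   ∎
      where open ≋-Reasoning

  Homogeneous₀-split : ∀ {F} → Homogeneous 0 F → F ≋ const (F 0) ⊕ mono ℓ ⊛ shift ℓ F
  Homogeneous₀-split {F} F-hom n = begin
    F n                                         ≈⟨ solve 2 (λ x c → x := c :+ (x :- c)) refl (F n) (const (F 0) n) ⟩
    const (F 0) n + (F ⊖ const (F 0)) n         ≈⟨ +-congˡ (Ord≥⇒≋mono⊛shift ℓ _ F-F₀≥ℓ n) ⟩
    const (F 0) n + (mono ℓ ⊛ shift ℓ (F ⊖ const (F 0))) n
                                                ≈⟨ +-congˡ (⊛-congˡ (mono ℓ) shift-const n) ⟩
    const (F 0) n + (mono ℓ ⊛ shift ℓ F) n      ∎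
    where
    open ≈-Reasoning
    open IntegerRingSolver R
    F-F₀≥ℓ : Ord≥ ℓ (F ⊖ const (F 0))
    F-F₀≥ℓ = Homogeneous₀⇒Ord≥ℓ (Homogeneous-⊖ F-hom (Homogeneous-const (F 0))) (-‿inverseʳ _)
    shift-const : shift ℓ (F ⊖ const (F 0)) ≋ shift ℓ F
    shift-const j = trans (+-congˡ (trans (-‿cong const-vanishes) -0#≈0#)) (+-identityʳ _)
      where
      const-vanishes : const (F 0) (j ℕ.+ ℓ) ≈ 0#
      const-vanishes = const-≢0 (F 0) (j ℕ.+ ℓ) (ℕ.≢-nonZero⁻¹ ℓ ∘ ℕP.m+n≡0⇒n≡0 j)

module ProductionMatrix
  {a r} (R : CommutativeRing a r) (inv : CommutativeRing.Carrier R → CommutativeRing.Carrier R)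
  (isField : IsField R inv) (charZero : CharZero R) (ℓ-1 : ℕ)
  (b g : Series.FPS R inv) (f : ℕ → Series.FPS R inv) (h h̄ : Series.FPS R inv)
  (b∈K[[tˡ]] : Series.InPowℓ R inv (suc ℓ-1) b) (g∈K[[tˡ]] : Series.InPowℓ R inv (suc ℓ-1) g)
  (f∈tK[[tˡ]] : ∀ j → 1 ≤ j → j ≤ suc ℓ-1 → Series.InTPowℓ R inv (suc ℓ-1) (f j))
  (b₀≉0 : ¬ (CommutativeRing._≈_ R (b 0) (CommutativeRing.0# R)))
  (g₀≉0 : ¬ (CommutativeRing._≈_ R (g 0) (CommutativeRing.0# R)))
  (f₁≉0 : ∀ j → 1 ≤ j → j ≤ suc ℓ-1 → ¬ (CommutativeRing._≈_ R (f j 1) (CommutativeRing.0# R)))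
  (h₀≈0 : CommutativeRing._≈_ R (h 0) (CommutativeRing.0# R))
  (hˡ≋∏f : Series._≋_ R inv (Series.pow R inv h (suc ℓ-1)) (Series.prodS R inv (suc ℓ-1) f))
  (h̄-inverse : Series.IsCompInverse R inv h h̄)
  where

  open import Relation.Nullary using (yes; no)
  open import Relation.Nullary.Decidable using (dec-true; dec-false)
  open import Relation.Binary.Definitions using (tri<; tri≈; tri>)
  open import Data.Bool using (Bool; if_then_else_)
  import Data.Nat as ℕ
  open import Data.Nat using (_∸_)
  open import Data.Nat.DivMod using (_/_; _%_; m/n≡1+[m∸n]/n; m<n⇒m/n≡0; m%n<n; m≡m%n+[m/n]*n; n%n≡0)
  import Data.Nat.Properties as ℕP
  open import Algebra.Properties.CommutativeSemigroup ℕP.+-commutativeSemigroup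
    using (xy∙z≈xz∙y; x∙yz≈xz∙y)
  open import Data.Product using (proj₁; proj₂)
  open import Relation.Binary.PropositionalEquality as ≡ using (_≡_; _≢_)
  open CommutativeRing R
  open FiniteSums R inv
  open PowerSeriesRing R inv
  open FieldProperties R inv isField

  ℓ : ℕ
  ℓ = suc ℓ-1

  open GradedSeries R inv ℓ
  open Series.MultipleAlmostRiordan R inv ℓ b g f h̄

  h≥1 : Ord≥ 1 h
  h≥1 zero    _         = h₀≈0
  h≥1 (suc n) (s≤s ())

  open Composition h h≥1

  h̄≥1 : Ord≥ 1 h̄
  h̄≥1 zero    _         = proj₁ (proj₂ h̄-inverse)
  h̄≥1 (suc n) (s≤s ())

  h∘h̄≋X : comp h h̄ ≋ X
  h∘h̄≋X = proj₁ (proj₂ (proj₂ h̄-inverse))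

  h̄∘h≋X : comp h̄ h ≋ X
  h̄∘h≋X = proj₂ (proj₂ (proj₂ h̄-inverse))

  comp-h̄-h : ∀ G → comp (comp G h̄) h ≋ G
  comp-h̄-h G = ≋-trans (comp-assoc G h̄ h h̄≥1 h≥1) (≋-trans (comp-congʳ G h̄∘h≋X) (comp-X-right G))

  f/t : ℕ → FPS
  f/t i = shift 1 (f i)

  f≥1 : ∀ i → 1 ≤ i → i ≤ ℓ → Ord≥ 1 (f i)
  f≥1 i 1≤i i≤ℓ zero    _         = proj₁ (f∈tK[[tˡ]] i 1≤i i≤ℓ)
  f≥1 i 1≤i i≤ℓ (suc n) (s≤s ())

  f≋X⊛f/t : ∀ i → 1 ≤ i → i ≤ ℓ → f i ≋ X ⊛ f/t i
  f≋X⊛f/t i 1≤i i≤ℓ = Ord≥⇒≋mono⊛shift 1 (f i) (f≥1 i 1≤i i≤ℓ)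

  f/t-hom : ∀ i → 1 ≤ i → i ≤ ℓ → Homogeneous 0 (f/t i)
  f/t-hom i 1≤i i≤ℓ = InPowℓ⇒Homogeneous₀ (proj₂ (f∈tK[[tˡ]] i 1≤i i≤ℓ))

  b-hom : Homogeneous 0 b
  b-hom = InPowℓ⇒Homogeneous₀ b∈K[[tˡ]]

  g-hom : Homogeneous 0 g
  g-hom = InPowℓ⇒Homogeneous₀ g∈K[[tˡ]]

  prodS-f : ∀ m → m ≤ ℓ → prodS m f ≋ mono m ⊛ prodS m f/t
  prodS-f m m≤ℓ = begin
    prodS m f                              ≈⟨ prodS-cong m (λ i 1≤i i≤m → f≋X⊛f/t i 1≤i (ℕP.≤-trans i≤m m≤ℓ)) ⟩
    prodS m (λ i → X ⊛ f/t i)              ≈⟨ prodS-⊛ m (λ _ → X) f/t ⟩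
    prodS m (λ _ → X) ⊛ prodS m f/t        ≈⟨ ⊛-congʳ (prodS m f/t) (≋-trans (prodS-const m X) (pow-X m)) ⟩
    mono m ⊛ prodS m f/t                   ∎
    where open ≋-Reasoning

  ∏f : FPS
  ∏f = prodS ℓ f

  ∏f≥ℓ : Ord≥ ℓ ∏f
  ∏f≥ℓ = Ord≥-prodS ℓ f f≥1

  h/t : FPS
  h/t = shift 1 h

  [h/t]ˡ : FPS
  [h/t]ˡ = pow h/t ℓ

  hˡ≋mono⊛[h/t]ˡ : pow h ℓ ≋ mono ℓ ⊛ [h/t]ˡ
  hˡ≋mono⊛[h/t]ˡ = begin
    pow h ℓ                   ≈⟨ pow-cong ℓ (Ord≥⇒≋mono⊛shift 1 h h≥1) ⟩
    pow (X ⊛ h/t) ℓ           ≈⟨ pow-⊛ X h/t ℓ ⟩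
    pow X ℓ ⊛ [h/t]ˡ          ≈⟨ ⊛-congʳ [h/t]ˡ (pow-X ℓ) ⟩
    mono ℓ ⊛ [h/t]ˡ           ∎
    where open ≋-Reasoning

  ∏f≋mono⊛[h/t]ˡ : ∏f ≋ mono ℓ ⊛ [h/t]ˡ
  ∏f≋mono⊛[h/t]ˡ = ≋-trans (≋-sym hˡ≋∏f) hˡ≋mono⊛[h/t]ˡ

  [h/t]ˡ≋∏f/t : [h/t]ˡ ≋ prodS ℓ f/t
  [h/t]ˡ≋∏f/t = mono-⊛-injective ℓ (≋-trans (≋-sym ∏f≋mono⊛[h/t]ˡ) (prodS-f ℓ ℕP.≤-refl))

  [h/t]ˡ-coeff-0 : [h/t]ˡ 0 ≈ prodK ℓ (λ i → f i 1)
  [h/t]ˡ-coeff-0 = trans ([h/t]ˡ≋∏f/t 0) (prodS-coeff-0 ℓ f/t)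

  [h/t]ˡ₀≉0 : ¬ ([h/t]ˡ 0 ≈ 0#)
  [h/t]ˡ₀≉0 [h/t]ˡ₀≈0 = prodK-≉0 ℓ (λ i → f i 1) f₁≉0 (trans (sym [h/t]ˡ-coeff-0) [h/t]ˡ₀≈0)

  h/t-hom : Homogeneous 0 h/t
  h/t-hom = Homogeneous₀-root isField ℓ-1 h/t (charZero ℓ-1) h/t₀≉0
    (Homogeneous-cong (≋-sym [h/t]ˡ≋∏f/t) (Homogeneous₀-prodS ℓ f/t f/t-hom))
    where
    h/t₀≉0 : ¬ (h/t 0 ≈ 0#)
    h/t₀≉0 h/t₀≈0 = [h/t]ˡ₀≉0 (trans (*-congˡ h/t₀≈0) (zeroʳ _))

  h-hom : Homogeneous 1 h
  h-hom = Homogeneous-cong (≋-sym (Ord≥⇒≋mono⊛shift 1 h h≥1)) (Homogeneous-⊛ Homogeneous-X h/t-hom)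

  h̄-hom : Homogeneous 1 h̄
  h̄-hom = Homogeneous-compInverse h-hom h≥1 h̄≥1 h∘h̄≋X h̄∘h≋X

  u-hom : Homogeneous 0 u
  u-hom = Homogeneous-shift 1 h̄-hom

  A-hom : Homogeneous 0 Aser
  A-hom = Homogeneous₀-invS (Homogeneous₀-pow u-hom ℓ)

  h/t⊛u∘h≋1 : h/t ⊛ comp u h ≋ oneS
  h/t⊛u∘h≋1 = mono-⊛-injective 1 (begin
    X ⊛ (h/t ⊛ comp u h)      ≈⟨ ≋-sym (⊛-assoc X h/t (comp u h)) ⟩
    (X ⊛ h/t) ⊛ comp u h      ≈⟨ ⊛-congʳ (comp u h) (Ord≥⇒≋mono⊛shift 1 h h≥1) ⟨
    h ⊛ comp u h              ≈⟨ ⊛-congʳ (comp u h) comp-X ⟨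
    comp X h ⊛ comp u h       ≈⟨ ≋-sym (comp-⊛ X u) ⟩
    comp (X ⊛ u) h            ≈⟨ comp-congˡ (≋-sym (Ord≥⇒≋mono⊛shift 1 h̄ h̄≥1)) ⟩
    comp h̄ h                  ≈⟨ h̄∘h≋X ⟩
    X                         ≈⟨ ≋-sym (⊛-identityʳ X) ⟩
    X ⊛ oneS                  ∎)
    where open ≋-Reasoning

  A∘h≋[h/t]ˡ : comp Aser h ≋ [h/t]ˡ
  A∘h≋[h/t]ˡ = ≋-trans (comp-invS (pow u ℓ) (≉0⇒Unit (pow u ℓ) uˡ₀≉0) (≉0⇒Unit (comp (pow u ℓ) h) uˡ∘h₀≉0))
    (≋-sym (invS-unique (comp (pow u ℓ) h) (≉0⇒Unit (comp (pow u ℓ) h) uˡ∘h₀≉0) [h/t]ˡ uˡ∘h⊛[h/t]ˡ≋1))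
    where
    uˡ∘h⊛[h/t]ˡ≋1 : comp (pow u ℓ) h ⊛ [h/t]ˡ ≋ oneS
    uˡ∘h⊛[h/t]ˡ≋1 = begin
      comp (pow u ℓ) h ⊛ [h/t]ˡ          ≈⟨ ⊛-congʳ [h/t]ˡ (comp-pow u ℓ) ⟩
      pow (comp u h) ℓ ⊛ pow h/t ℓ       ≈⟨ ≋-sym (pow-⊛ (comp u h) h/t ℓ) ⟩
      pow (comp u h ⊛ h/t) ℓ             ≈⟨ pow-cong ℓ (≋-trans (⊛-comm _ _) h/t⊛u∘h≋1) ⟩
      pow oneS ℓ                         ≈⟨ pow-oneS ℓ ⟩
      oneS                               ∎
      where open ≋-Reasoning
    uˡ∘h₀≉0 : ¬ (comp (pow u ℓ) h 0 ≈ 0#)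
    uˡ∘h₀≉0 eq = IsField.1≉0 isField (trans (sym (uˡ∘h⊛[h/t]ˡ≋1 0)) (trans (*-congʳ eq) (zeroˡ _)))
    uˡ₀≉0 : ¬ (pow u ℓ 0 ≈ 0#)
    uˡ₀≉0 eq = uˡ∘h₀≉0 (trans (comp-coeff-0 (pow u ℓ) h) eq)

  [m+ℓ]/ℓ≡1+m/ℓ : ∀ m → (m ℕ.+ ℓ) / ℓ ≡ suc (m / ℓ)
  [m+ℓ]/ℓ≡1+m/ℓ m = ≡.trans (m/n≡1+[m∸n]/n (ℕP.m≤n+m ℓ m)) (≡.cong (λ x → suc (x / ℓ)) (ℕP.m+n∸n≡m m ℓ))

  e-+ℓ : ∀ i s → e i (suc s ℕ.+ ℓ) ≡ suc (e i (suc s))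
  e-+ℓ i s = begin
    (s ℕ.+ ℓ ℕ.+ (ℓ ∸ i)) / ℓ       ≡⟨ ≡.cong (_/ ℓ) (xy∙z≈xz∙y s ℓ (ℓ ∸ i)) ⟩
    (s ℕ.+ (ℓ ∸ i) ℕ.+ ℓ) / ℓ       ≡⟨ [m+ℓ]/ℓ≡1+m/ℓ (s ℕ.+ (ℓ ∸ i)) ⟩
    suc ((s ℕ.+ (ℓ ∸ i)) / ℓ)       ∎
    where open ≡.≡-Reasoning

  e-≤ : ∀ i s → i ≤ s → s < ℓ → e i (suc s) ≡ 1
  e-≤ i s i≤s s<ℓ = begin
    (s ℕ.+ (ℓ ∸ i)) / ℓ         ≡⟨ ≡.cong (_/ ℓ) (ℕP.+-∸-assoc s (ℕP.≤-trans i≤s (ℕP.<⇒≤ s<ℓ))) ⟨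
    (s ℕ.+ ℓ ∸ i) / ℓ           ≡⟨ ≡.cong (_/ ℓ) (ℕP.+-∸-comm ℓ i≤s) ⟩
    (s ∸ i ℕ.+ ℓ) / ℓ           ≡⟨ [m+ℓ]/ℓ≡1+m/ℓ (s ∸ i) ⟩
    suc ((s ∸ i) / ℓ)           ≡⟨ ≡.cong suc (m<n⇒m/n≡0 (ℕP.≤-<-trans (ℕP.m∸n≤m s i) s<ℓ)) ⟩
    1                           ∎
    where open ≡.≡-Reasoning

  e-> : ∀ i s → s < i → i ≤ ℓ → e i (suc s) ≡ 0
  e-> i s s<i i≤ℓ = m<n⇒m/n≡0 (≡.subst (s ℕ.+ (ℓ ∸ i) <_) (ℕP.m+[n∸m]≡n i≤ℓ) (ℕP.+-monoˡ-< (ℓ ∸ i) s<i))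

  colD-+ℓ : ∀ s → colD (suc s ℕ.+ ℓ) ≋ colD (suc s) ⊛ ∏f
  colD-+ℓ s = begin
    X ⊛ g ⊛ prodS ℓ (λ i → pow (f i) (e i (suc s ℕ.+ ℓ)))
      ≈⟨ ⊛-congˡ (X ⊛ g) (prodS-cong ℓ (λ i _ _ → ≡⇒≋ (≡.cong (pow (f i)) (e-+ℓ i s)))) ⟩
    X ⊛ g ⊛ prodS ℓ (λ i → pow (f i) (e i (suc s)) ⊛ f i)
      ≈⟨ ⊛-congˡ (X ⊛ g) (prodS-⊛ ℓ _ f) ⟩
    X ⊛ g ⊛ (prodS ℓ (λ i → pow (f i) (e i (suc s))) ⊛ ∏f)
      ≈⟨ ≋-sym (⊛-assoc (X ⊛ g) _ ∏f) ⟩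
    colD (suc s) ⊛ ∏f                                               ∎
    where open ≋-Reasoning

  colD-<ℓ : ∀ s → s < ℓ → colD (suc s) ≋ mono (suc s) ⊛ (g ⊛ prodS s f/t)
  colD-<ℓ s s<ℓ = begin
    X ⊛ g ⊛ prodS ℓ (λ i → pow (f i) (e i (suc s)))
      ≈⟨ ⊛-congˡ (X ⊛ g) (prodS-oneS-tail s ℓ _ (ℕP.<⇒≤ s<ℓ) pow-e>) ⟩
    X ⊛ g ⊛ prodS s (λ i → pow (f i) (e i (suc s)))
      ≈⟨ ⊛-congˡ (X ⊛ g) (prodS-cong s pow-e≤) ⟩
    X ⊛ g ⊛ prodS s f
      ≈⟨ ⊛-congˡ (X ⊛ g) (prodS-f s (ℕP.<⇒≤ s<ℓ)) ⟩
    X ⊛ g ⊛ (mono s ⊛ prodS s f/t)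
      ≈⟨ solve 4 (λ x y z w → (x :* y) :* (z :* w) := (x :* z) :* (y :* w)) ≋-refl X g (mono s) (prodS s f/t) ⟩
    X ⊛ mono s ⊛ (g ⊛ prodS s f/t)
      ≈⟨ ⊛-congʳ (g ⊛ prodS s f/t) (X⊛mono s) ⟩
    mono (suc s) ⊛ (g ⊛ prodS s f/t)                  ∎
    where
    open ≋-Reasoning
    open SeriesSolver
    pow-e> : ∀ i → s < i → i ≤ ℓ → pow (f i) (e i (suc s)) ≋ oneS
    pow-e> i s<i i≤ℓ = ≡⇒≋ (≡.cong (pow (f i)) (e-> i s s<i i≤ℓ))
    pow-e≤ : ∀ i → 1 ≤ i → i ≤ s → pow (f i) (e i (suc s)) ≋ f i
    pow-e≤ i _ i≤s = ≋-trans (≡⇒≋ (≡.cong (pow (f i)) (e-≤ i s i≤s s<ℓ))) (⊛-identityˡ (f i))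

  colD-+qℓ : ∀ s q → colD (suc s ℕ.+ q ℕ.* ℓ) ≋ colD (suc s) ⊛ pow ∏f q
  colD-+qℓ s zero    = ≋-trans (≡⇒≋ (≡.cong colD (ℕP.+-identityʳ (suc s)))) (≋-sym (⊛-identityʳ _))
  colD-+qℓ s (suc q) = begin
    colD (suc s ℕ.+ (ℓ ℕ.+ q ℕ.* ℓ))           ≡⟨ ≡.cong (λ j → colD (suc j)) (x∙yz≈xz∙y s ℓ (q ℕ.* ℓ)) ⟩
    colD (suc (s ℕ.+ q ℕ.* ℓ) ℕ.+ ℓ)           ≈⟨ colD-+ℓ (s ℕ.+ q ℕ.* ℓ) ⟩
    colD (suc s ℕ.+ q ℕ.* ℓ) ⊛ ∏f              ≈⟨ ⊛-congʳ ∏f (colD-+qℓ s q) ⟩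
    colD (suc s) ⊛ pow ∏f q ⊛ ∏f               ≈⟨ ⊛-assoc (colD (suc s)) (pow ∏f q) ∏f ⟩
    colD (suc s) ⊛ pow ∏f (suc q)              ∎
    where open ≋-Reasoning

  colD≥ : ∀ j → Ord≥ j (colD j)
  colD≥ zero    _ ()
  colD≥ (suc j) = ≡.subst (λ i → Ord≥ i (colD i)) (≡.cong suc (≡.sym (m≡m%n+[m/n]*n j ℓ)))
    (Ord≥-cong (≋-sym (≋-trans (colD-+qℓ ρ q) (⊛-congʳ (pow ∏f q) (colD-<ℓ ρ (m%n<n j ℓ)))))
      (Ord≥-⊛ (Ord≥-mono-⊛ (suc ρ) (g ⊛ prodS ρ f/t)) (Ord≥-pow ∏f≥ℓ q)))
    where
    ρ : ℕ
    ρ = j % ℓ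
    q : ℕ
    q = j / ℓ

  colD-+i : ∀ s i → i ≡ₘ 0 → colD (suc s ℕ.+ i) ≋ colD (suc s) ⊛ pow h i
  colD-+i s i i≡0 = begin
    colD (suc s ℕ.+ i)                 ≡⟨ ≡.cong (λ j → colD (suc s ℕ.+ j)) i≡qℓ ⟩
    colD (suc s ℕ.+ q ℕ.* ℓ)           ≈⟨ colD-+qℓ s q ⟩
    colD (suc s) ⊛ pow ∏f q            ≈⟨ ⊛-congˡ (colD (suc s)) (pow-cong q hˡ≋∏f) ⟨
    colD (suc s) ⊛ pow (pow h ℓ) q     ≈⟨ ⊛-congˡ (colD (suc s)) (pow-pow h ℓ q) ⟩
    colD (suc s) ⊛ pow h (q ℕ.* ℓ)     ≡⟨ ≡.cong (λ j → colD (suc s) ⊛ pow h j) i≡qℓ ⟨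
    colD (suc s) ⊛ pow h i             ∎
    where
    open ≋-Reasoning
    q : ℕ
    q = i / ℓ
    i≡qℓ : i ≡ q ℕ.* ℓ
    i≡qℓ = ≡.trans (m≡m%n+[m/n]*n i ℓ) (≡.cong (ℕ._+ q ℕ.* ℓ) (≡.trans i≡0 0%ℓ≡0))

  rowSum-mono⊛ : ∀ s Z → Homogeneous 0 Z → ∀ n →
                 Σ≤ n (λ j → d n j * (mono (suc s) ⊛ Z) j) ≈ (colD (suc s) ⊛ comp Z h) n
  rowSum-mono⊛ s Z Z-hom n with n ℕ.<? suc s
  ... | yes n<1+s = trans
    (Σ≤-zero n _ (λ j j≤n → trans (*-congˡ (mono-⊛-< (suc s) Z j (ℕP.≤-<-trans j≤n n<1+s))) (zeroʳ _)))
    (sym (≡.subst (λ i → Ord≥ i (colD (suc s) ⊛ comp Z h)) (ℕP.+-identityʳ (suc s))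
                  (Ord≥-⊛ {g = comp Z h} (colD≥ (suc s)) (λ _ ())) n n<1+s))
  ... | no  n≮1+s = begin
    Σ≤ n (λ j → d n j * (mono (suc s) ⊛ Z) j)
      ≈⟨ Σ≤-drop (suc s) n _ 1+s≤n (λ j j<1+s → trans (*-congˡ (mono-⊛-< (suc s) Z j j<1+s)) (zeroʳ _)) ⟩
    Σ≤ (n ∸ suc s) (λ i → d n (suc s ℕ.+ i) * (mono (suc s) ⊛ Z) (suc s ℕ.+ i))
      ≈⟨ Σ≤-cong (n ∸ suc s) term ⟩
    Σ≤ (n ∸ suc s) (λ i → Z i * (colD (suc s) ⊛ pow h i) n)
      ≈⟨ Σ≤-extend (n ∸ suc s) n _ (ℕP.m∸n≤m n (suc s)) beyond ⟨
    Σ≤ n (λ i → Z i * (colD (suc s) ⊛ pow h i) n)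
      ≈⟨ ⊛-comp (colD (suc s)) Z n ⟨
    (colD (suc s) ⊛ comp Z h) n                                  ∎
    where
    open ≈-Reasoning
    1+s≤n : suc s ≤ n
    1+s≤n = ℕP.≮⇒≥ n≮1+s
    beyond : ∀ i → n ∸ suc s < i → i ≤ n → Z i * (colD (suc s) ⊛ pow h i) n ≈ 0#
    beyond i n∸1+s<i _ = trans (*-congˡ (Ord≥-⊛ (colD≥ (suc s)) (Ord≥-pow₁ h≥1 i) n
      (≡.subst (_< suc s ℕ.+ i) (ℕP.m+[n∸m]≡n 1+s≤n) (ℕP.+-monoʳ-< (suc s) n∸1+s<i)))) (zeroʳ _)
    term : ∀ i → d n (suc s ℕ.+ i) * (mono (suc s) ⊛ Z) (suc s ℕ.+ i) ≈ Z i * (colD (suc s) ⊛ pow h i) n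
    term i with i % ℓ ℕ.≟ 0 % ℓ
    ... | yes i≡0 = trans (*-cong (colD-+i s i i≡0 n) Z-coeff) (*-comm _ _)
      where
      Z-coeff : (mono (suc s) ⊛ Z) (suc s ℕ.+ i) ≈ Z i
      Z-coeff = trans (reflexive (≡.cong (mono (suc s) ⊛ Z) (ℕP.+-comm (suc s) i))) (mono-⊛-+ (suc s) Z i)
    ... | no  i≢0 = trans (*-congˡ Z-coeff) (trans (zeroʳ _) (sym (trans (*-congʳ (vanish Z-hom i i≢0)) (zeroˡ _))))
      where
      Z-coeff : (mono (suc s) ⊛ Z) (suc s ℕ.+ i) ≈ 0#
      Z-coeff = trans (reflexive (≡.cong (mono (suc s) ⊛ Z) (ℕP.+-comm (suc s) i)))
                      (trans (mono-⊛-+ (suc s) Z i) (vanish Z-hom i i≢0))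

  rowSum : ∀ Z → Homogeneous 0 Z → ∀ n → Σ≤ n (λ j → d n j * Z j) ≈ b n * Z 0 + (colD ℓ ⊛ comp (shift ℓ Z) h) n
  rowSum Z Z-hom n = begin
    Σ≤ n (λ j → d n j * Z j)
      ≈⟨ Σ≤-cong n (λ j → *-congˡ (Homogeneous₀-split Z-hom j)) ⟩
    Σ≤ n (λ j → d n j * (const (Z 0) j + (mono ℓ ⊛ shift ℓ Z) j))
      ≈⟨ trans (Σ≤-cong n (λ j → distribˡ _ _ _)) (Σ≤-distrib-+ n _ _) ⟩
    Σ≤ n (λ j → d n j * const (Z 0) j) + Σ≤ n (λ j → d n j * (mono ℓ ⊛ shift ℓ Z) j)
      ≈⟨ +-cong (Σ≤-head n _ (λ i → zeroʳ _)) (rowSum-mono⊛ ℓ-1 (shift ℓ Z) (Homogeneous₀-shiftℓ Z-hom) n) ⟩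
    b n * Z 0 + (colD ℓ ⊛ comp (shift ℓ Z) h) n                               ∎
    where open ≈-Reasoning

  gh-hom : Homogeneous 0 gh
  gh-hom = Homogeneous-comp g-hom h̄-hom

  bh-hom : Homogeneous 0 bh
  bh-hom = Homogeneous-comp b-hom h̄-hom

  Fh-hom : ∀ i → 1 ≤ i → i ≤ ℓ → Homogeneous 0 (Fh i)
  Fh-hom i 1≤i i≤ℓ = Homogeneous-comp (f/t-hom i 1≤i i≤ℓ) h̄-hom

  gh-unit : Unit gh
  gh-unit = ≉0⇒Unit gh (λ gh₀≈0 → g₀≉0 (trans (sym (comp-coeff-0 g h̄)) gh₀≈0))

  g⁻¹ : FPS
  g⁻¹ = comp (invS gh) h

  g⊛g⁻¹≋1 : g ⊛ g⁻¹ ≋ oneS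
  g⊛g⁻¹≋1 = begin
    g ⊛ g⁻¹                   ≈⟨ ⊛-congʳ g⁻¹ (≋-sym (comp-h̄-h g)) ⟩
    comp gh h ⊛ g⁻¹           ≈⟨ ≋-sym (comp-⊛ gh (invS gh)) ⟩
    comp (gh ⊛ invS gh) h     ≈⟨ comp-congˡ (invS-inverseʳ gh gh-unit) ⟩
    comp oneS h               ≈⟨ comp-oneS ⟩
    oneS                      ∎
    where open ≋-Reasoning

  f/tℓ-unit : Unit (f/t ℓ)
  f/tℓ-unit = ≉0⇒Unit (f/t ℓ) (f₁≉0 ℓ (s≤s z≤n) ℕP.≤-refl)

  colD-ℓ⊛f/tℓ : colD ℓ ⊛ f/t ℓ ≋ mono ℓ ⊛ (g ⊛ [h/t]ˡ)
  colD-ℓ⊛f/tℓ = begin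
    colD ℓ ⊛ f/t ℓ
      ≈⟨ ⊛-congʳ (f/t ℓ) (colD-<ℓ ℓ-1 ℕP.≤-refl) ⟩
    mono ℓ ⊛ (g ⊛ prodS ℓ-1 f/t) ⊛ f/t ℓ
      ≈⟨ solve 4 (λ m x y z → (m :* (x :* y)) :* z := m :* (x :* (y :* z))) ≋-refl (mono ℓ) g (prodS ℓ-1 f/t) (f/t ℓ) ⟩
    mono ℓ ⊛ (g ⊛ prodS ℓ f/t)
      ≈⟨ ⊛-congˡ (mono ℓ) (⊛-congˡ g (≋-sym [h/t]ˡ≋∏f/t)) ⟩
    mono ℓ ⊛ (g ⊛ [h/t]ˡ)                            ∎
    where
    open ≋-Reasoning
    open SeriesSolver

  comp-Ord≥ℓ : ∀ Z → Ord≥ ℓ Z → comp Z h ≋ mono ℓ ⊛ ([h/t]ˡ ⊛ comp (shift ℓ Z) h)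
  comp-Ord≥ℓ Z Z≥ℓ = ≋-trans (comp-Ord≥ ℓ Z Z≥ℓ)
    (≋-trans (⊛-congʳ (comp (shift ℓ Z) h) hˡ≋mono⊛[h/t]ˡ) (⊛-assoc (mono ℓ) [h/t]ˡ (comp (shift ℓ Z) h)))

  comp-Homogeneous₀ : ∀ Z → Homogeneous 0 Z → comp Z h ≋ const (Z 0) ⊕ mono ℓ ⊛ ([h/t]ˡ ⊛ comp (shift ℓ Z) h)
  comp-Homogeneous₀ Z Z-hom = begin
    comp Z h
      ≈⟨ comp-congˡ (Homogeneous₀-split Z-hom) ⟩
    comp (const (Z 0) ⊕ mono ℓ ⊛ shift ℓ Z) h
      ≈⟨ comp-⊕ _ _ ⟩
    comp (const (Z 0)) h ⊕ comp (mono ℓ ⊛ shift ℓ Z) h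
      ≈⟨ ⊕-cong (comp-const (Z 0)) (comp-⊛ (mono ℓ) (shift ℓ Z)) ⟩
    const (Z 0) ⊕ comp (mono ℓ) h ⊛ comp (shift ℓ Z) h
      ≈⟨ ⊕-cong ≋-refl (⊛-congʳ (comp (shift ℓ Z) h) (≋-trans (comp-mono ℓ) hˡ≋mono⊛[h/t]ˡ)) ⟩
    const (Z 0) ⊕ mono ℓ ⊛ [h/t]ˡ ⊛ comp (shift ℓ Z) h
      ≈⟨ ⊕-cong ≋-refl (⊛-assoc (mono ℓ) [h/t]ˡ (comp (shift ℓ Z) h)) ⟩
    const (Z 0) ⊕ mono ℓ ⊛ ([h/t]ˡ ⊛ comp (shift ℓ Z) h)       ∎
    where open ≋-Reasoning

  -- Multiplying by the unit f_ℓ/t turns col_ℓ = tˡ g (f₁/t)⋯(f_{ℓ-1}/t) into tˡ g (h/t)ˡ, and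
  -- tˡ (h/t)ˡ (shift ℓ Z)(h) = Z(h) - Z(0).
  column-via-f/tℓ : ∀ Z c T → Homogeneous 0 Z → Z 0 ≈ c →
                    f/t ℓ ⊛ (const c ⊛ b) ⊕ g ⊛ (comp Z h ⊖ const c) ≋ f/t ℓ ⊛ T →
                    const c ⊛ b ⊕ colD ℓ ⊛ comp (shift ℓ Z) h ≋ T
  column-via-f/tℓ Z c T Z-hom Z₀≈c eq = ⊛-cancelʳ-Unit F f/tℓ-unit _ T (begin
    (const c ⊛ b ⊕ colD ℓ ⊛ CZ) ⊛ F
      ≈⟨ solve 4 (λ cb D z fℓ → (cb :+ D :* z) :* fℓ := fℓ :* cb :+ (D :* fℓ) :* z)
           ≋-refl (const c ⊛ b) (colD ℓ) CZ F ⟩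
    F ⊛ (const c ⊛ b) ⊕ (colD ℓ ⊛ F) ⊛ CZ
      ≈⟨ ⊕-cong ≋-refl (⊛-congʳ CZ colD-ℓ⊛f/tℓ) ⟩
    F ⊛ (const c ⊛ b) ⊕ mono ℓ ⊛ (g ⊛ [h/t]ˡ) ⊛ CZ
      ≈⟨ ⊕-cong ≋-refl (solve 4 (λ m x y z → (m :* (x :* y)) :* z := x :* (m :* (y :* z))) ≋-refl (mono ℓ) g [h/t]ˡ CZ) ⟩
    F ⊛ (const c ⊛ b) ⊕ g ⊛ (mono ℓ ⊛ ([h/t]ˡ ⊛ CZ)) ≈⟨ ⊕-cong ≋-refl (⊛-congˡ g tail≋) ⟩
    F ⊛ (const c ⊛ b) ⊕ g ⊛ (comp Z h ⊖ const c)
      ≈⟨ eq ⟩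
    F ⊛ T
      ≈⟨ ⊛-comm F T ⟩
    T ⊛ F                                           ∎)
    where
    open ≋-Reasoning
    open SeriesSolver
    F : FPS
    F = f/t ℓ
    CZ : FPS
    CZ = comp (shift ℓ Z) h
    tail≋ : mono ℓ ⊛ ([h/t]ˡ ⊛ CZ) ≋ comp Z h ⊖ const c
    tail≋ = ≋-trans (solve 2 (λ x z₀ → x := (z₀ :+ x) :- z₀) ≋-refl _ (const (Z 0)))
              (⊖-cong (≋-sym (comp-Homogeneous₀ Z Z-hom)) (const-cong Z₀≈c))

  rowSum-via-f/tℓ : ∀ Z c T → Homogeneous 0 Z → Z 0 ≈ c →
                    f/t ℓ ⊛ (const c ⊛ b) ⊕ g ⊛ (comp Z h ⊖ const c) ≋ f/t ℓ ⊛ T →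
                    ∀ n → Σ≤ n (λ j → d n j * Z j) ≈ T n
  rowSum-via-f/tℓ Z c T Z-hom Z₀≈c eq n = begin
    Σ≤ n (λ j → d n j * Z j)
      ≈⟨ rowSum Z Z-hom n ⟩
    b n * Z 0 + (colD ℓ ⊛ comp (shift ℓ Z) h) n
      ≈⟨ +-congʳ (trans (*-congˡ Z₀≈c) (trans (*-comm _ _) (sym (const⊛ c b n)))) ⟩
    (const c ⊛ b ⊕ colD ℓ ⊛ comp (shift ℓ Z) h) n
      ≈⟨ column-via-f/tℓ Z c T Z-hom Z₀≈c eq n ⟩
    T n                                                       ∎
    where open ≈-Reasoning

  column->ℓ : ∀ s → colD (suc s) ⊛ comp Aser h ≋ shift ℓ (colD (suc s ℕ.+ ℓ))
  column->ℓ s = begin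
    colD (suc s) ⊛ comp Aser h
      ≈⟨ ⊛-congˡ (colD (suc s)) A∘h≋[h/t]ˡ ⟩
    colD (suc s) ⊛ [h/t]ˡ
      ≈⟨ shift-mono-⊛ ℓ _ ⟨
    shift ℓ (mono ℓ ⊛ (colD (suc s) ⊛ [h/t]ˡ))
      ≈⟨ shift-cong ℓ (solve 3 (λ m x y → m :* (x :* y) := x :* (m :* y)) ≋-refl (mono ℓ) (colD (suc s)) [h/t]ˡ) ⟩
    shift ℓ (colD (suc s) ⊛ (mono ℓ ⊛ [h/t]ˡ))
      ≈⟨ shift-cong ℓ (⊛-congˡ (colD (suc s)) ∏f≋mono⊛[h/t]ˡ) ⟨
    shift ℓ (colD (suc s) ⊛ ∏f)
      ≈⟨ shift-cong ℓ (colD-+ℓ s) ⟨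
    shift ℓ (colD (suc s ℕ.+ ℓ))                    ∎
    where
    open ≋-Reasoning
    open SeriesSolver

  module Column<ℓ (s : ℕ) (1+s<ℓ : suc s < ℓ) where

    s≤ℓ : s ≤ ℓ
    s≤ℓ = ℕP.≤-trans (ℕP.n≤1+n s) (ℕP.<⇒≤ 1+s<ℓ)

    c : Carrier
    c = cst s
    W : FPS
    W = gh ⊛ prodS s Fh
    Q : FPS
    Q = oneS ⊖ scale c (invS W)

    c≉0 : ¬ (c ≈ 0#)
    c≉0 = *-≉0 g₀≉0 (prodK-≉0 s _ (λ i 1≤i i≤s → f₁≉0 i 1≤i (ℕP.≤-trans i≤s s≤ℓ)))

    W₀≈c : W 0 ≈ c
    W₀≈c = *-cong (comp-coeff-0 g h̄) (trans (prodS-coeff-0 s Fh) (prodK-cong s (λ i → comp-coeff-0 (f/t i) h̄)))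

    W-unit : Unit W
    W-unit = ≉0⇒Unit W (λ W₀≈0 → c≉0 (trans (sym W₀≈c) W₀≈0))

    W∘h≋ : comp W h ≋ g ⊛ prodS s f/t
    W∘h≋ = ≋-trans (comp-⊛ gh (prodS s Fh))
      (⊛-cong (comp-h̄-h g) (≋-trans (comp-prodS s Fh) (prodS-cong s (λ i _ _ → comp-h̄-h (f/t i)))))

    W∘h-unit : Unit (comp W h)
    W∘h-unit = ≉0⇒Unit (comp W h) (λ W∘h₀≈0 → c≉0 (trans (sym W₀≈c) (trans (sym (comp-coeff-0 W h)) W∘h₀≈0)))

    Q-hom : Homogeneous 0 Q
    Q-hom = Homogeneous-⊖ Homogeneous-oneS (Homogeneous-scale c (Homogeneous₀-invS
      (Homogeneous-⊛ gh-hom (Homogeneous₀-prodS s Fh (λ i 1≤i i≤s → Fh-hom i 1≤i (ℕP.≤-trans i≤s s≤ℓ))))))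

    Q≥ℓ : Ord≥ ℓ Q
    Q≥ℓ = Homogeneous₀⇒Ord≥ℓ Q-hom
      (trans (+-congˡ (-‿cong (trans (*-congˡ (*-identityʳ _)) (trans (*-congʳ (sym W₀≈c)) W-unit)))) (-‿inverseʳ _))

    Q∘h≋ : comp Q h ≋ oneS ⊖ const c ⊛ invS (comp W h)
    Q∘h≋ = ≋-trans (comp-⊖ oneS _) (⊖-cong comp-oneS
      (≋-trans (comp-scale c _) (≋-trans (scale-cong refl (comp-invS W W-unit W∘h-unit)) (≋-sym (const⊛ c _)))))

    Z-hom : Homogeneous 0 (Zser (suc s))
    Z-hom = Homogeneous-⊛ A-hom (Homogeneous₀-shiftℓ Q-hom)

    column : colD (suc s) ⊛ comp (Zser (suc s)) h ≋ shift ℓ (colD (suc s))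
    column = begin
      D ⊛ comp (Aser ⊛ shift ℓ Q) h
        ≈⟨ ⊛-congˡ D (≋-trans (comp-⊛ Aser (shift ℓ Q)) (⊛-congʳ CQ A∘h≋[h/t]ˡ)) ⟩
      D ⊛ ([h/t]ˡ ⊛ CQ)
        ≈⟨ shift-mono-⊛ ℓ (D ⊛ ([h/t]ˡ ⊛ CQ)) ⟨
      shift ℓ (mono ℓ ⊛ (D ⊛ ([h/t]ˡ ⊛ CQ)))
        ≈⟨ shift-cong ℓ (solve 3 (λ m x y → m :* (x :* y) := x :* (m :* y)) ≋-refl (mono ℓ) D ([h/t]ˡ ⊛ CQ)) ⟩
      shift ℓ (D ⊛ (mono ℓ ⊛ ([h/t]ˡ ⊛ CQ)))
        ≈⟨ shift-cong ℓ (⊛-congˡ D (comp-Ord≥ℓ Q Q≥ℓ)) ⟨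
      shift ℓ (D ⊛ comp Q h)
        ≈⟨ shift-cong ℓ (⊛-congˡ D Q∘h≋) ⟩
      shift ℓ (D ⊛ (oneS ⊖ const c ⊛ J))
        ≈⟨ shift-cong ℓ (solve 3 (λ x y z → x :* (con (+ 1) :- y :* z) := x :- y :* (x :* z)) ≋-refl D (const c) J) ⟩
      shift ℓ (D ⊖ const c ⊛ (D ⊛ J))
        ≈⟨ shift-cong ℓ (⊖-cong (≋-refl {D}) (⊛-congˡ (const c) D⊛J≋mono)) ⟩
      shift ℓ (D ⊖ const c ⊛ mono (suc s))
        ≈⟨ mono-vanishes ⟩
      shift ℓ D                                  ∎
      where
      open ≋-Reasoning
      open SeriesSolver
      open import Data.Integer using (+_)
      D : FPS
      D = colD (suc s)
      CQ : FPS
      CQ = comp (shift ℓ Q) h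
      J : FPS
      J = invS (comp W h)
      D⊛J≋mono : D ⊛ J ≋ mono (suc s)
      D⊛J≋mono = begin
        D ⊛ J
          ≈⟨ ⊛-congʳ J (≋-trans (colD-<ℓ s (ℕP.<-trans (ℕP.n<1+n s) 1+s<ℓ))
                                (⊛-congˡ (mono (suc s)) (≋-sym W∘h≋))) ⟩
        mono (suc s) ⊛ comp W h ⊛ J
          ≈⟨ ⊛-assoc (mono (suc s)) (comp W h) J ⟩
        mono (suc s) ⊛ (comp W h ⊛ J)
          ≈⟨ ⊛-congˡ (mono (suc s)) (invS-inverseʳ (comp W h) W∘h-unit) ⟩
        mono (suc s) ⊛ oneS
          ≈⟨ ⊛-identityʳ (mono (suc s)) ⟩
        mono (suc s)                             ∎
      mono-vanishes : shift ℓ (D ⊖ const c ⊛ mono (suc s)) ≋ shift ℓ D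
      mono-vanishes n = trans (+-congˡ (trans (-‿cong (trans (const⊛ c (mono (suc s)) (n ℕ.+ ℓ))
        (trans (*-congˡ (mono-offDiagonal (suc s) (n ℕ.+ ℓ) n+ℓ≢1+s)) (zeroʳ _)))) -0#≈0#)) (+-identityʳ _)
        where
        open import Algebra.Properties.Ring ring using (-0#≈0#)
        n+ℓ≢1+s : n ℕ.+ ℓ ≢ suc s
        n+ℓ≢1+s n+ℓ≡1+s = ℕP.<-irrefl (≡.sym n+ℓ≡1+s) (ℕP.<-≤-trans 1+s<ℓ (ℕP.m≤n+m ℓ n))

  f/tℓ⊛shift-colDℓ : f/t ℓ ⊛ shift ℓ (colD ℓ) ≋ g ⊛ [h/t]ˡ
  f/tℓ⊛shift-colDℓ = begin
    f/t ℓ ⊛ shift ℓ (colD ℓ)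
      ≈⟨ ⊛-congˡ (f/t ℓ) (shift-cong ℓ (colD-<ℓ ℓ-1 ℕP.≤-refl)) ⟩
    f/t ℓ ⊛ shift ℓ (mono ℓ ⊛ (g ⊛ prodS ℓ-1 f/t))
      ≈⟨ ⊛-congˡ (f/t ℓ) (shift-mono-⊛ ℓ (g ⊛ prodS ℓ-1 f/t)) ⟩
    f/t ℓ ⊛ (g ⊛ prodS ℓ-1 f/t)
      ≈⟨ solve 3 (λ x y z → x :* (y :* z) := y :* (z :* x)) ≋-refl (f/t ℓ) g (prodS ℓ-1 f/t) ⟩
    g ⊛ prodS ℓ f/t
      ≈⟨ ⊛-congˡ g (≋-sym [h/t]ˡ≋∏f/t) ⟩
    g ⊛ [h/t]ˡ                                                ∎
    where
    open ≋-Reasoning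
    open SeriesSolver

  module Columnℓ where

    z₀ : Carrier
    z₀ = cst ℓ-1 * inv b₀
    K : FPS
    K = b ⊛ f/t ℓ ⊛ g⁻¹

    Z-hom : Homogeneous 0 Zℓser
    Z-hom = Homogeneous-⊖ (Homogeneous-⊕ (Homogeneous-const z₀) A-hom)
      (Homogeneous-scale z₀ (Homogeneous-⊛ (Homogeneous-⊛ bh-hom (Fh-hom ℓ (s≤s z≤n) ℕP.≤-refl))
                                           (Homogeneous₀-invS gh-hom)))

    Z∘h≋ : comp Zℓser h ≋ const z₀ ⊕ [h/t]ˡ ⊖ const z₀ ⊛ K
    Z∘h≋ = ≋-trans (comp-⊖ _ _) (⊖-cong (≋-trans (comp-⊕ _ _) (⊕-cong (comp-const z₀) A∘h≋[h/t]ˡ))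
      (≋-trans (comp-scale z₀ _) (≋-trans (scale-cong refl K∘h) (≋-sym (const⊛ z₀ K)))))
      where
      K∘h : comp (bh ⊛ Fh ℓ ⊛ invS gh) h ≋ K
      K∘h = ≋-trans (comp-⊛ (bh ⊛ Fh ℓ) (invS gh))
        (⊛-congʳ g⁻¹ (≋-trans (comp-⊛ bh (Fh ℓ)) (⊛-cong (comp-h̄-h b) (comp-h̄-h (f/t ℓ)))))

    Z₀≈z₀ : Zℓser 0 ≈ z₀
    Z₀≈z₀ = begin
      Zℓser 0
        ≈⟨ comp-coeff-0 Zℓser h ⟨
      comp Zℓser h 0
        ≈⟨ Z∘h≋ 0 ⟩
      z₀ + [h/t]ˡ 0 - z₀ * ((b₀ * f ℓ 1) * g⁻¹ 0)
        ≈⟨ +-congˡ (-‿cong (solve 6 (λ g₀ p ib b₀ fℓ ig →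
           ((g₀ :* p) :* ib) :* ((b₀ :* fℓ) :* ig) := (g₀ :* ig) :* (b₀ :* ib) :* (p :* fℓ))
           refl g₀ (prodK ℓ-1 (λ i → f i 1)) (inv b₀) b₀ (f ℓ 1) (g⁻¹ 0))) ⟩
      z₀ + [h/t]ˡ 0 - (g₀ * g⁻¹ 0) * (b₀ * inv b₀) * prodK ℓ (λ i → f i 1)
        ≈⟨ +-congˡ (-‿cong (*-cong (*-cong (g⊛g⁻¹≋1 0) (IsField.inverse isField b₀ b₀≉0)) (sym [h/t]ˡ-coeff-0))) ⟩
      z₀ + [h/t]ˡ 0 - (1# * 1#) * [h/t]ˡ 0
        ≈⟨ solve 2 (λ x y → x :+ y :- (con (+ 1) :* con (+ 1)) :* y := x) refl z₀ ([h/t]ˡ 0) ⟩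
      z₀                                                ∎
      where
      open ≈-Reasoning
      open IntegerRingSolver R
      open import Data.Integer using (+_)

    identity : f/t ℓ ⊛ (const z₀ ⊛ b) ⊕ g ⊛ (comp Zℓser h ⊖ const z₀) ≋ f/t ℓ ⊛ shift ℓ (colD ℓ)
    identity = begin
      F ⊛ (c ⊛ b) ⊕ g ⊛ (comp Zℓser h ⊖ c)
        ≈⟨ ⊕-cong ≋-refl (⊛-congˡ g (⊖-cong Z∘h≋ (≋-refl {c}))) ⟩
      F ⊛ (c ⊛ b) ⊕ g ⊛ ((c ⊕ [h/t]ˡ ⊖ c ⊛ (b ⊛ F ⊛ g⁻¹)) ⊖ c)
        ≈⟨ solve 6 (λ F c b g V I → F :* (c :* b) :+ g :* ((c :+ V :- c :* (b :* F :* I)) :- c)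
           := g :* V :+ (c :* b :* F) :* (con (+ 1) :- g :* I)) ≋-refl F c b g [h/t]ˡ g⁻¹ ⟩
      g ⊛ [h/t]ˡ ⊕ (c ⊛ b ⊛ F) ⊛ (oneS ⊖ g ⊛ g⁻¹)
        ≈⟨ ⊕-cong ≋-refl (⊛-congˡ (c ⊛ b ⊛ F) (⊖-cong (≋-refl {oneS}) g⊛g⁻¹≋1)) ⟩
      g ⊛ [h/t]ˡ ⊕ (c ⊛ b ⊛ F) ⊛ (oneS ⊖ oneS)
        ≈⟨ solve 2 (λ x y → x :+ y :* (con (+ 1) :- con (+ 1)) := x) ≋-refl (g ⊛ [h/t]ˡ) (c ⊛ b ⊛ F) ⟩
      g ⊛ [h/t]ˡ
        ≈⟨ f/tℓ⊛shift-colDℓ ⟨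
      F ⊛ shift ℓ (colD ℓ)                                  ∎
      where
      open ≋-Reasoning
      open SeriesSolver
      open import Data.Integer using (+_)
      F : FPS
      F = f/t ℓ
      c : FPS
      c = const z₀

  module Column₀ where

    B : FPS
    B = (oneS ⊖ scale w₀ (pow h̄ ℓ)) ⊛ bh ⊖ const b₀
    CB : FPS
    CB = comp (shift ℓ B) h

    B-hom : Homogeneous 0 B
    B-hom = Homogeneous-⊖
      (Homogeneous-⊛ (Homogeneous-⊖ Homogeneous-oneS (Homogeneous-scale w₀ h̄ˡ-hom)) bh-hom) (Homogeneous-const b₀)
      where
      ℓ*1≡ₘ0 : ℓ ℕ.* 1 ≡ₘ 0
      ℓ*1≡ₘ0 = ≡.trans (≡.cong (_% ℓ) (ℕP.*-identityʳ ℓ)) (≡.trans (n%n≡0 ℓ) (≡.sym 0%ℓ≡0))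
      h̄ˡ-hom : Homogeneous 0 (pow h̄ ℓ)
      h̄ˡ-hom = Homogeneous-resp-≡ₘ ℓ*1≡ₘ0 (Homogeneous-pow h̄-hom ℓ)

    B₀≈0 : B 0 ≈ 0#
    B₀≈0 = trans (+-congʳ (*-congʳ (+-congˡ (-‿cong (*-congˡ (trans (*-congˡ (h̄≥1 0 (s≤s z≤n))) (zeroʳ _)))))))
      (solve 2 (λ w b₀ → (con (+ 1) :- w :* con (+ 0)) :* (b₀ :* con (+ 1)) :- b₀ := con (+ 0)) refl w₀ b₀)
      where
      open IntegerRingSolver R
      open import Data.Integer using (+_)

    B∘h≋mono⊛ : comp B h ≋ mono ℓ ⊛ ([h/t]ˡ ⊛ CB)
    B∘h≋mono⊛ = comp-Ord≥ℓ B (Homogeneous₀⇒Ord≥ℓ B-hom B₀≈0)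

    B∘h≋ : comp B h ≋ b ⊖ const w₀ ⊛ (mono ℓ ⊛ b) ⊖ const b₀
    B∘h≋ = begin
      comp B h
        ≈⟨ comp-⊖ _ _ ⟩
      comp ((oneS ⊖ scale w₀ (pow h̄ ℓ)) ⊛ bh) h ⊖ comp (const b₀) h
        ≈⟨ ⊖-cong (comp-⊛ _ bh) (comp-const b₀) ⟩
      comp (oneS ⊖ scale w₀ (pow h̄ ℓ)) h ⊛ comp bh h ⊖ const b₀
        ≈⟨ ⊖-cong (⊛-cong (≋-trans (comp-⊖ oneS _) (⊖-cong comp-oneS (comp-scale w₀ _))) (comp-h̄-h b)) ≋-refl ⟩
      (oneS ⊖ scale w₀ (comp (pow h̄ ℓ) h)) ⊛ b ⊖ const b₀
        ≈⟨ ⊖-cong (⊛-congʳ b (⊖-cong ≋-refl (scale-cong refl h̄ˡ∘h≋mono))) ≋-refl ⟩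
      (oneS ⊖ scale w₀ (mono ℓ)) ⊛ b ⊖ const b₀
        ≈⟨ ⊖-cong (⊛-congʳ b (⊖-cong ≋-refl (≋-sym (const⊛ w₀ (mono ℓ))))) ≋-refl ⟩
      (oneS ⊖ const w₀ ⊛ mono ℓ) ⊛ b ⊖ const b₀
        ≈⟨ solve 4 (λ c m b b₀ → (con (+ 1) :- c :* m) :* b :- b₀ := b :- c :* (m :* b) :- b₀)
           ≋-refl (const w₀) (mono ℓ) b (const b₀) ⟩
      b ⊖ const w₀ ⊛ (mono ℓ ⊛ b) ⊖ const b₀
        ∎
      where
      open ≋-Reasoning
      open SeriesSolver
      open import Data.Integer using (+_)
      h̄ˡ∘h≋mono : comp (pow h̄ ℓ) h ≋ mono ℓ
      h̄ˡ∘h≋mono = ≋-trans (comp-pow h̄ ℓ) (≋-trans (pow-cong ℓ h̄∘h≋X) (pow-X ℓ))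

    -- Comparing the coefficients of t^ℓ in the two expressions for B(h).
    Bℓ≈0 : B ℓ ≈ 0#
    Bℓ≈0 = trans (sym (*-identityʳ _)) (no-zero-divisors [h/t]ˡ₀≉0 (begin
      [h/t]ˡ 0 * (B ℓ * 1#)                      ≈⟨ mono-⊛-+ ℓ ([h/t]ˡ ⊛ CB) 0 ⟨
      (mono ℓ ⊛ ([h/t]ˡ ⊛ CB)) ℓ                 ≈⟨ B∘h≋mono⊛ ℓ ⟨
      comp B h ℓ                                 ≈⟨ B∘h≋ ℓ ⟩
      (b ℓ - (const w₀ ⊛ (mono ℓ ⊛ b)) ℓ) - 0#   ≈⟨ +-congʳ (+-congˡ (-‿cong w₀b₀≈bℓ)) ⟩
      (b ℓ - b ℓ) - 0#                           ≈⟨ solve 1 (λ x → (x :- x) :- con (+ 0) := con (+ 0)) refl (b ℓ) ⟩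
      0#                                         ∎))
      where
      open ≈-Reasoning
      open IntegerRingSolver R
      open import Data.Integer using (+_)
      w₀b₀≈bℓ : (const w₀ ⊛ (mono ℓ ⊛ b)) ℓ ≈ b ℓ
      w₀b₀≈bℓ = begin
        (const w₀ ⊛ (mono ℓ ⊛ b)) ℓ   ≈⟨ const⊛ w₀ (mono ℓ ⊛ b) ℓ ⟩
        w₀ * (mono ℓ ⊛ b) ℓ           ≈⟨ *-congˡ (mono-⊛-+ ℓ b 0) ⟩
        (b ℓ * inv b₀) * b₀           ≈⟨ *-assoc _ _ _ ⟩
        b ℓ * (inv b₀ * b₀)           ≈⟨ *-congˡ (trans (*-comm _ _) (IsField.inverse isField b₀ b₀≉0)) ⟩
        b ℓ * 1#                      ≈⟨ *-identityʳ _ ⟩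
        b ℓ                           ∎

    W₀≈w₀ : Wser 0 ≈ w₀
    W₀≈w₀ = trans (+-congʳ (trans (*-congˡ Bℓ≈0) (zeroʳ _))) (+-identityˡ _)

    W-hom : Homogeneous 0 Wser
    W-hom = Homogeneous-⊕
      (Homogeneous-⊛ (Homogeneous-⊛ (Homogeneous-⊛ (Fh-hom ℓ (s≤s z≤n) ℕP.≤-refl) (Homogeneous₀-invS gh-hom)) A-hom)
      (Homogeneous₀-shiftℓ B-hom)) (Homogeneous-const w₀)

    W∘h≋ : comp Wser h ≋ f/t ℓ ⊛ g⁻¹ ⊛ [h/t]ˡ ⊛ CB ⊕ const w₀
    W∘h≋ = ≋-trans (comp-⊕ _ _) (⊕-cong (≋-trans (comp-⊛ _ (shift ℓ B)) (⊛-congʳ CB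
      (≋-trans (comp-⊛ (Fh ℓ ⊛ invS gh) Aser)
               (⊛-cong (≋-trans (comp-⊛ (Fh ℓ) (invS gh)) (⊛-congʳ g⁻¹ (comp-h̄-h (f/t ℓ)))) A∘h≋[h/t]ˡ))))
      (comp-const w₀))

    shift-b : const w₀ ⊛ b ⊕ [h/t]ˡ ⊛ CB ≋ shift ℓ b
    shift-b = mono-⊛-injective ℓ (begin
      mono ℓ ⊛ (c ⊛ b ⊕ [h/t]ˡ ⊛ CB)
        ≈⟨ solve 4 (λ m x y z → m :* (x :+ y :* z) := m :* x :+ m :* (y :* z)) ≋-refl (mono ℓ) (c ⊛ b) [h/t]ˡ CB ⟩
      mono ℓ ⊛ (c ⊛ b) ⊕ mono ℓ ⊛ ([h/t]ˡ ⊛ CB)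
        ≈⟨ ⊕-cong ≋-refl (≋-trans (≋-sym B∘h≋mono⊛) B∘h≋) ⟩
      mono ℓ ⊛ (c ⊛ b) ⊕ (b ⊖ c ⊛ (mono ℓ ⊛ b) ⊖ const b₀)
        ≈⟨ solve 4 (λ m c b b₀ → m :* (c :* b) :+ (b :- c :* (m :* b) :- b₀) := b :- b₀) ≋-refl (mono ℓ) c b (const b₀) ⟩
      b ⊖ const b₀
        ≈⟨ ⊖-cong (Homogeneous₀-split b-hom) (≋-refl {const b₀}) ⟩
      (const b₀ ⊕ mono ℓ ⊛ shift ℓ b) ⊖ const b₀
        ≈⟨ solve 2 (λ x y → (x :+ y) :- x := y) ≋-refl (const b₀) (mono ℓ ⊛ shift ℓ b) ⟩
      mono ℓ ⊛ shift ℓ b                                      ∎)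
      where
      open ≋-Reasoning
      open SeriesSolver
      open import Data.Integer using (+_)
      c : FPS
      c = const w₀

    identity : f/t ℓ ⊛ (const w₀ ⊛ b) ⊕ g ⊛ (comp Wser h ⊖ const w₀) ≋ f/t ℓ ⊛ shift ℓ b
    identity = begin
      F ⊛ (c ⊛ b) ⊕ g ⊛ (comp Wser h ⊖ c)
        ≈⟨ ⊕-cong ≋-refl (⊛-congˡ g (⊖-cong W∘h≋ (≋-refl {c}))) ⟩
      F ⊛ (c ⊛ b) ⊕ g ⊛ ((F ⊛ g⁻¹ ⊛ [h/t]ˡ ⊛ CB ⊕ c) ⊖ c)
        ≈⟨ solve 7 (λ F c b g I V C → F :* (c :* b) :+ g :* ((F :* I :* V :* C :+ c) :- c)
           := F :* (c :* b) :+ F :* (V :* C) :* (g :* I)) ≋-refl F c b g g⁻¹ [h/t]ˡ CB ⟩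
      F ⊛ (c ⊛ b) ⊕ F ⊛ ([h/t]ˡ ⊛ CB) ⊛ (g ⊛ g⁻¹)
        ≈⟨ ⊕-cong ≋-refl (⊛-congˡ (F ⊛ ([h/t]ˡ ⊛ CB)) g⊛g⁻¹≋1) ⟩
      F ⊛ (c ⊛ b) ⊕ F ⊛ ([h/t]ˡ ⊛ CB) ⊛ oneS
        ≈⟨ solve 4 (λ F x y z → F :* x :+ F :* (y :* z) :* con (+ 1) := F :* (x :+ y :* z)) ≋-refl F (c ⊛ b) [h/t]ˡ CB ⟩
      F ⊛ (c ⊛ b ⊕ [h/t]ˡ ⊛ CB)
        ≈⟨ ⊛-congˡ F shift-b ⟩
      F ⊛ shift ℓ b                                           ∎
      where
      open ≋-Reasoning
      open SeriesSolver
      open import Data.Integer using (+_)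
      F : FPS
      F = f/t ℓ
      c : FPS
      c = const w₀

  -- colP (suc s) is definitionally colP-branches (suc s <ᵇ ℓ) (suc s ≡ᵇ ℓ) s.
  colP-branches : Bool → Bool → ℕ → FPS
  colP-branches c c′ s =
    if c then mono (suc s) ⊛ Zser (suc s) else if c′ then Zℓser else mono (suc s ∸ ℓ) ⊛ Aser

  colP-< : ∀ s → suc s < ℓ → colP (suc s) ≡ mono (suc s) ⊛ Zser (suc s)
  colP-< s 1+s<ℓ = ≡.cong (λ c → colP-branches c (suc s ℕ.≡ᵇ ℓ) s) (dec-true (suc s ℕ.<? ℓ) 1+s<ℓ)

  colP-ℓ : colP ℓ ≡ Zℓser
  colP-ℓ = ≡.cong₂ (λ c c′ → colP-branches c c′ ℓ-1)
    (dec-false (ℓ ℕ.<? ℓ) (ℕP.<-irrefl ≡.refl)) (dec-true (ℓ ℕ.≟ ℓ) ≡.refl)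

  colP-> : ∀ s → ℓ < suc s → colP (suc s) ≡ mono (suc s ∸ ℓ) ⊛ Aser
  colP-> s ℓ<1+s = ≡.cong₂ (λ c c′ → colP-branches c c′ s)
    (dec-false (suc s ℕ.<? ℓ) (ℕP.<-asym ℓ<1+s)) (dec-false (suc s ℕ.≟ ℓ) (ℕP.>⇒≢ ℓ<1+s))

  rowSum-colP : ∀ n k {Y} → colP k ≡ Y → Σ≤ n (λ j → d n j * P j k) ≈ Σ≤ n (λ j → d n j * Y j)
  rowSum-colP n k ≡.refl = refl

  isProductionMatrix : IsProductionMatrix ℓ d P
  isProductionMatrix n zero =
    rowSum-via-f/tℓ Wser w₀ (shift ℓ b) Column₀.W-hom Column₀.W₀≈w₀ Column₀.identity n
  isProductionMatrix n (suc s) with ℕ.<-cmp (suc s) ℓ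
  ... | tri< 1+s<ℓ _ _ = begin
    Σ≤ n (λ j → d n j * P j (suc s))
      ≈⟨ rowSum-colP n (suc s) (colP-< s 1+s<ℓ) ⟩
    Σ≤ n (λ j → d n j * (mono (suc s) ⊛ Zser (suc s)) j)
      ≈⟨ rowSum-mono⊛ s (Zser (suc s)) (Column<ℓ.Z-hom s 1+s<ℓ) n ⟩
    (colD (suc s) ⊛ comp (Zser (suc s)) h) n
      ≈⟨ Column<ℓ.column s 1+s<ℓ n ⟩
    d (n ℕ.+ ℓ) (suc s)                                       ∎
    where open ≈-Reasoning
  ... | tri≈ _ ≡.refl _ = trans (rowSum-colP n ℓ colP-ℓ)
    (rowSum-via-f/tℓ Zℓser Columnℓ.z₀ (shift ℓ (colD ℓ)) Columnℓ.Z-hom Columnℓ.Z₀≈z₀ Columnℓ.identity n)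
  ... | tri> _ _ ℓ<1+s = begin
    Σ≤ n (λ j → d n j * P j (suc s))
      ≈⟨ rowSum-colP n (suc s) (≡.trans (colP-> s ℓ<1+s) (≡.cong (λ i → mono i ⊛ Aser) 1+s∸ℓ≡1+[s∸ℓ])) ⟩
    Σ≤ n (λ j → d n j * (mono (suc s∸ℓ) ⊛ Aser) j)
      ≈⟨ rowSum-mono⊛ s∸ℓ Aser A-hom n ⟩
    (colD (suc s∸ℓ) ⊛ comp Aser h) n
      ≈⟨ column->ℓ s∸ℓ n ⟩
    d (n ℕ.+ ℓ) (suc s∸ℓ ℕ.+ ℓ)
      ≡⟨ ≡.cong (λ i → d (n ℕ.+ ℓ) (suc i)) (ℕP.m∸n+n≡m ℓ≤s) ⟩
    d (n ℕ.+ ℓ) (suc s)                                       ∎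
    where
    open ≈-Reasoning
    ℓ≤s : ℓ ≤ s
    ℓ≤s = ℕP.≤-pred ℓ<1+s
    s∸ℓ : ℕ
    s∸ℓ = s ∸ ℓ
    1+s∸ℓ≡1+[s∸ℓ] : suc s ∸ ℓ ≡ suc s∸ℓ
    1+s∸ℓ≡1+[s∸ℓ] = ℕP.+-∸-assoc 1 ℓ≤s

theorem3p2 : ∀ {a r : Level} (R : CommutativeRing a r)
    → let open CommutativeRing R in
      (inv : Carrier → Carrier) → IsField R inv → CharZero R
    → (ℓ : ℕ) .{{_ : NonZero ℓ}} → 2 ≤ ℓ
    → (b g : Series.FPS R inv) (f : ℕ → Series.FPS R inv) (h hbar : Series.FPS R inv)
    → Series.InPowℓ R inv ℓ b → Series.InPowℓ R inv ℓ g
    → (∀ j → 1 ≤ j → j ≤ ℓ → Series.InTPowℓ R inv ℓ (f j))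
    → ¬ (b 0 ≈ 0#) → ¬ (g 0 ≈ 0#)
    → (∀ j → 1 ≤ j → j ≤ ℓ → ¬ (f j 1 ≈ 0#))
    → h 0 ≈ 0#
    → Series._≋_ R inv (Series.pow R inv h ℓ) (Series.prodS R inv ℓ f)
    → Series.IsCompInverse R inv h hbar
    → Series.IsProductionMatrix R inv ℓ
        (Series.MultipleAlmostRiordan.d R inv ℓ b g f hbar)
        (Series.MultipleAlmostRiordan.P R inv ℓ b g f hbar)
-- The argument works for every ℓ ≥ 1; the hypothesis 2 ≤ ℓ only serves to write ℓ as a successor.
theorem3p2 R inv isField charZero _ (s≤s (s≤s (z≤n {m}))) = ProductionMatrix.isProductionMatrix R inv isField charZero (suc m)
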